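{- Let $\Gamma$ be a DOAG and $X$ a set. Then the standard structure $\operatorname{Stan}(\Gamma^X)=(\Gamma^X,\mathcal{P}(X),f\mapsto\{f\geq0\})$ is an algebraically closed densely valued $\ell$-group.
   Context: All $\ell$-groups are abelian lattice-ordered groups; a DOAG is a nontrivial divisible totally ordered abelian group. $\Gamma^X$ is the $\ell$-group of functions $X\to\Gamma$ with pointwise operations, $\mathcal{P}(X)$ the power set lattice ($\cap,\cup,\emptyset,X$), and $\{f\geq0\}=\{x\in X: f(x)\geq0\}$. A valued $\ell$-group is a triple $(\mathcal{G},\mathcal{L},P)$ with $\mathcal{G}$ an $\ell$-group, $\mathcal{L}$ a bounded distributive lattice ($\sqcap,\sqcup,\bot,\top,\sqsubseteq$), and $P:\mathcal{G}\to\mathcal{L}$ such that for all $a,b$: $P(a\wedge b)=P(a)\sqcap P(b)$, $P(a\vee b)=P(a)\sqcup P(b)$, $P(0)=\top$, $P(a)\sqcap P(b)\sqsubseteq P(a+b)$, and every element of $\mathcal{L}$ other than $\bot$ is of the form $P(a)$; it is densely valued if moreover $P(a)=\top$ implies $a\geq0$. Valued $\ell$-groups are structures in the two-sorted language $\mathcal{L}_{\mathrm{vlgrp}}$ with a group sort (symbols $0,+,-,\wedge,\vee$), a lattice sort (symbols $\bot,\top,\sqcap,\sqcup$) and a function symbol $P$ from the group sort to the lattice sort; $\mathcal{V}\leq\mathcal{W}$ means substructure. A densely valued $\ell$-group $\mathcal{V}$ is algebraically closed if for every densely valued $\ell$-group $\mathcal{W}\geq\mathcal{V}$, every positive existential $\mathcal{L}_{\mathrm{vlgrp}}$-formula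 $\phi(\bar v)$ and every tuple $\bar c$ from $\mathcal{V}$ of matching sorts, $\mathcal{W}\models\phi(\bar c)$ implies $\mathcal{V}\models\phi(\bar c)$. -}

module Defs where

open import Level using (Level; _⊔_; Lift; lift; Setω) renaming (suc to lsuc)
open import Data.Nat using (ℕ; zero; suc)
open import Data.Fin using (Fin; zero; suc)
open import Data.Product using (Σ; ∃; _×_; _,_)
open import Data.Sum using (_⊎_)
open import Data.Unit using (⊤)
open import Data.Empty using (⊥)
open import Function using (_∘_; _⇔_)
open import Relation.Nullary using (¬_; yes; no)
open import Relation.Binary using (Rel; IsDecTotalOrder)
open import Relation.Unary using (Pred; _∩_; _∪_)
open import Algebra.Core using (Op₁; Op₂)
open import Algebra.Structures using (IsAbelianGroup)
open import Algebra.Lattice.Structures using (IsLattice; IsDistributiveLattice)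

-- DOAG: nontrivial divisible totally ordered abelian group
-- (carrier with setoid equality _≈_; the total order is taken decidable,
--  which is harmless classically and lets us define pointwise min/max).

times : ∀ {c} {A : Set c} → Op₂ A → A → ℕ → A → A
times _+_ e zero    b = e
times _+_ e (suc n) b = b + times _+_ e n b

record DOAG (c ℓ : Level) : Set (lsuc (c ⊔ ℓ)) where
  infix  4 _≈_ _≤_
  infixl 6 _+_
  field
    Carrier         : Set c
    _≈_             : Rel Carrier ℓ
    _≤_             : Rel Carrier ℓ
    _+_             : Op₂ Carrier
    0#              : Carrier
    -_              : Op₁ Carrier
    isAbelianGroup  : IsAbelianGroup _≈_ _+_ 0# -_
    isDecTotalOrder : IsDecTotalOrder _≈_ _≤_
    +-mono          : ∀ a b c → a ≤ b → (a + c) ≤ (b + c)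
    divisible  : ∀ (n : ℕ) (a : Carrier) → ∃ λ b → (times _+_ 0# (suc n) b) ≈ a
    nontrivial : ∃ λ a → ¬ (a ≈ 0#)

  open IsDecTotalOrder isDecTotalOrder using (_≤?_)

  min : Op₂ Carrier
  min a b with a ≤? b
  ... | yes _ = a
  ... | no  _ = b

  max : Op₂ Carrier
  max a b with a ≤? b
  ... | yes _ = b
  ... | no  _ = a

record VLStructure (gc ge lc le : Level) : Set (lsuc (gc ⊔ ge ⊔ lc ⊔ le)) where
  infix  4 _≈G_ _≈L_
  field
    G    : Set gc
    _≈G_ : Rel G ge
    0G   : G
    _+_  : Op₂ G
    -_   : Op₁ G
    _∧_  : Op₂ G
    _∨_  : Op₂ G
    L    : Set lc
    _≈L_ : Rel L le
    ⊥L   : L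
    ⊤L   : L
    _⊓_  : Op₂ L
    _⊔L_ : Op₂ L
    P    : G → L

  _≤G_ : Rel G ge
  a ≤G b = (a ∧ b) ≈G a

  _⊑_ : Rel L le
  l ⊑ k = (l ⊓ k) ≈L l

record IsValuedLGroup {gc ge lc le} (S : VLStructure gc ge lc le)
       : Set (gc ⊔ ge ⊔ lc ⊔ le) where
  open VLStructure S
  field
    isAbelianGroup : IsAbelianGroup _≈G_ _+_ 0G -_
    isLattice      : IsLattice _≈G_ _∨_ _∧_
    +-mono         : ∀ a b c → a ≤G b → (a + c) ≤G (b + c)
    isDistributiveLattice : IsDistributiveLattice _≈L_ _⊔L_ _⊓_
    ⊥-identity     : ∀ l → (⊥L ⊔L l) ≈L l
    ⊤-identity     : ∀ l → (⊤L ⊓ l) ≈L l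
    P-cong         : ∀ {a b} → a ≈G b → P a ≈L P b
    P-∧            : ∀ a b → P (a ∧ b) ≈L (P a ⊓ P b)
    P-∨            : ∀ a b → P (a ∨ b) ≈L (P a ⊔L P b)
    P-0            : P 0G ≈L ⊤L
    P-+            : ∀ a b → (P a ⊓ P b) ⊑ P (a + b)
    P-onto         : ∀ l → ¬ (l ≈L ⊥L) → ∃ λ a → P a ≈L l

record IsDenselyValuedLGroup {gc ge lc le} (S : VLStructure gc ge lc le)
       : Set (gc ⊔ ge ⊔ lc ⊔ le) where
  open VLStructure S
  field
    isValuedLGroup : IsValuedLGroup S
    dense          : ∀ a → P a ≈L ⊤L → 0G ≤G a

-- Substructures: V ≤ W is rendered as an L_vlgrp-embedding V ↪ W
-- (injective on both sorts w.r.t. the setoid equalities, preserving all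
--  function symbols), i.e. V is isomorphic to a substructure of W.

record Embedding {a b c d a' b' c' d'}
       (V : VLStructure a b c d) (W : VLStructure a' b' c' d')
       : Set (a ⊔ b ⊔ c ⊔ d ⊔ a' ⊔ b' ⊔ c' ⊔ d') where
  private
    module V = VLStructure V
    module W = VLStructure W
  field
    fG      : V.G → W.G
    fL      : V.L → W.L
    fG-cong : ∀ {x y} → x V.≈G y → fG x W.≈G fG y
    fG-inj  : ∀ {x y} → fG x W.≈G fG y → x V.≈G y
    fL-cong : ∀ {x y} → x V.≈L y → fL x W.≈L fL y
    fL-inj  : ∀ {x y} → fL x W.≈L fL y → x V.≈L y
    f-0     : fG V.0G W.≈G W.0G
    f-+     : ∀ x y → fG (x V.+ y) W.≈G (fG x W.+ fG y)
    f--     : ∀ x → fG (V.- x) W.≈G (W.- fG x)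
    f-∧     : ∀ x y → fG (x V.∧ y) W.≈G (fG x W.∧ fG y)
    f-∨     : ∀ x y → fG (x V.∨ y) W.≈G (fG x W.∨ fG y)
    f-⊥     : fL V.⊥L W.≈L W.⊥L
    f-⊤     : fL V.⊤L W.≈L W.⊤L
    f-⊓     : ∀ x y → fL (x V.⊓ y) W.≈L (fL x W.⊓ fL y)
    f-⊔     : ∀ x y → fL (x V.⊔L y) W.≈L (fL x W.⊔L fL y)
    f-P     : ∀ x → fL (V.P x) W.≈L W.P (fG x)

-- Positive existential formulas of L_vlgrp, with n free group-sort
-- variables and m free lattice-sort variables (de Bruijn, Fin-indexed).

data GTerm (n : ℕ) : Set where
  var  : Fin n → GTerm n
  zer  : GTerm n
  _+ₜ_ : GTerm n → GTerm n → GTerm n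
  negₜ : GTerm n → GTerm n
  _∧ₜ_ : GTerm n → GTerm n → GTerm n
  _∨ₜ_ : GTerm n → GTerm n → GTerm n

data LTerm (n m : ℕ) : Set where
  var  : Fin m → LTerm n m
  botₜ : LTerm n m
  topₜ : LTerm n m
  _⊓ₜ_ : LTerm n m → LTerm n m → LTerm n m
  _⊔ₜ_ : LTerm n m → LTerm n m → LTerm n m
  Pₜ   : GTerm n → LTerm n m

data PEFormula : ℕ → ℕ → Set where
  trueF  : ∀ {n m} → PEFormula n m
  falseF : ∀ {n m} → PEFormula n m
  eqG    : ∀ {n m} → GTerm n → GTerm n → PEFormula n m
  eqL    : ∀ {n m} → LTerm n m → LTerm n m → PEFormula n m
  andF   : ∀ {n m} → PEFormula n m → PEFormula n m → PEFormula n m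
  orF    : ∀ {n m} → PEFormula n m → PEFormula n m → PEFormula n m
  existsG : ∀ {n m} → PEFormula (suc n) m → PEFormula n m
  existsL : ∀ {n m} → PEFormula n (suc m) → PEFormula n m

extend : ∀ {a} {A : Set a} {n} → A → (Fin n → A) → Fin (suc n) → A
extend x ρ zero    = x
extend x ρ (suc i) = ρ i

module _ {gc ge lc le} (S : VLStructure gc ge lc le) where
  open VLStructure S

  evalG : ∀ {n} → (Fin n → G) → GTerm n → G
  evalG ρ (var i)  = ρ i
  evalG ρ zer      = 0G
  evalG ρ (s +ₜ t) = evalG ρ s + evalG ρ t
  evalG ρ (negₜ t) = - evalG ρ t
  evalG ρ (s ∧ₜ t) = evalG ρ s ∧ evalG ρ t
  evalG ρ (s ∨ₜ t) = evalG ρ s ∨ evalG ρ t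

  evalL : ∀ {n m} → (Fin n → G) → (Fin m → L) → LTerm n m → L
  evalL ρ σ (var j)  = σ j
  evalL ρ σ botₜ     = ⊥L
  evalL ρ σ topₜ     = ⊤L
  evalL ρ σ (s ⊓ₜ t) = evalL ρ σ s ⊓ evalL ρ σ t
  evalL ρ σ (s ⊔ₜ t) = evalL ρ σ s ⊔L evalL ρ σ t
  evalL ρ σ (Pₜ t)   = P (evalG ρ t)

  Sat : ∀ {n m} → PEFormula n m → (Fin n → G) → (Fin m → L)
        → Set (gc ⊔ ge ⊔ lc ⊔ le)
  Sat trueF        ρ σ = Lift _ ⊤
  Sat falseF       ρ σ = Lift _ ⊥
  Sat (eqG s t)    ρ σ = Lift (gc ⊔ lc ⊔ le) (evalG ρ s ≈G evalG ρ t)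
  Sat (eqL s t)    ρ σ = Lift (gc ⊔ ge ⊔ lc) (evalL ρ σ s ≈L evalL ρ σ t)
  Sat (andF φ ψ)   ρ σ = Sat φ ρ σ × Sat ψ ρ σ
  Sat (orF φ ψ)    ρ σ = Sat φ ρ σ ⊎ Sat ψ ρ σ
  Sat (existsG φ)  ρ σ = Σ G λ x → Sat φ (extend x ρ) σ
  Sat (existsL φ)  ρ σ = Σ L λ y → Sat φ ρ (extend y σ)

AlgebraicallyClosed : ∀ {gc ge lc le} → VLStructure gc ge lc le → Setω
AlgebraicallyClosed V =
  ∀ {gc' ge' lc' le'} (W : VLStructure gc' ge' lc' le')
  → IsDenselyValuedLGroup W
  → (e : Embedding V W)
  → ∀ {n m} (φ : PEFormula n m)
      (cG : Fin n → VLStructure.G V) (cL : Fin m → VLStructure.L V)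
  → Sat W φ (Embedding.fG e ∘ cG) (Embedding.fL e ∘ cL)
  → Sat V φ cG cL

record IsAlgClosedDenselyValuedLGroup {gc ge lc le}
       (V : VLStructure gc ge lc le) : Setω where
  field
    isDenselyValued     : IsDenselyValuedLGroup V
    algebraicallyClosed : AlgebraicallyClosed V

Stan : ∀ {c ℓ x} → DOAG c ℓ → Set x → VLStructure (x ⊔ c) (x ⊔ ℓ) (x ⊔ lsuc ℓ) (x ⊔ ℓ)
Stan {c} {ℓ} {x} Γ X = record
  { G    = X → Carrier
  ; _≈G_ = λ f g → ∀ i → f i ≈ g i
  ; 0G   = λ _ → 0#
  ; _+_  = λ f g i → f i + g i
  ; -_   = λ f i → - f i
  ; _∧_  = λ f g i → min (f i) (g i)
  ; _∨_  = λ f g i → max (f i) (g i)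
  ; L    = Pred X ℓ
  ; _≈L_ = λ S T → ∀ i → S i ⇔ T i
  ; ⊥L   = λ _ → Lift ℓ ⊥
  ; ⊤L   = λ _ → Lift ℓ ⊤
  ; _⊓_  = _∩_
  ; _⊔L_ = _∪_
  ; P    = λ f i → 0# ≤ f i
  }
  where open DOAG Γ

module Submission where

-- Fix a point i of X. In an extension W of Stan(Γ^X), a prime filter of the value lattice of W lying over
-- the principal ultrafilter at i is built only as far as a given formula needs it: with excluded middle the
-- finitely many relevant values P(a) are decided one at a time, keeping every subset containing i true and
-- every subset avoiding i false. The decisions say which argument realises each ∧ and ∨ of the formula and
-- which P hold, turning the formula into finitely many linear constraints a ≥ 0, a > 0 that W satisfies
-- modulo the filter. Fourier–Motzkin elimination is sound for any such positivity, so the constraints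
-- without unknowns hold in W and therefore at i in Γ; as Γ is divisible, elimination is also complete over
-- Γ and yields a solution at i. Gluing the solutions at all points gives the witnesses in Γ^X.

open import Level using (Level; Lift; lift; lower) renaming (_⊔_ to _⊔ℓ_; suc to lsuc)
open import Data.Nat using (ℕ; zero; suc; compare; less; equal; greater) renaming (_+_ to _+ℕ_; _*_ to _*ℕ_)
open import Data.Nat.Properties using (*-comm; +-suc)
open import Data.Bool using (Bool; true; false; T) renaming (_∧_ to _∧ᵇ_; _∨_ to _∨ᵇ_)
open import Data.Bool.Properties using (T-∧; T-∨)
open import Data.Unit using (⊤; tt)
open import Data.Empty using (⊥; ⊥-elim)
open import Data.Product using (Σ; ∃; _×_; _,_; proj₁; proj₂; swap)
open import Data.Product.Function.NonDependent.Propositional using (_×-⇔_)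
open import Data.Sum using (_⊎_; inj₁; inj₂; [_,_])
open import Data.Sum.Function.Propositional using (_⊎-⇔_)
open import Data.Fin using (Fin; zero; suc; splitAt; _↑ˡ_; _↑ʳ_)
open import Data.Vec using (Vec; []; _∷_)
import Data.Vec as Vec
open import Data.Vec.Properties using (lookup∘tabulate)
import Data.Vec.Functional as Vector
open import Data.Vec.Functional.Properties using (lookup-++ˡ; lookup-++ʳ; ++-cong)
import Data.Vec.Functional.Relation.Binary.Pointwise.Properties as Pointwise
open import Data.List using (List; []; _∷_; _++_; map; cartesianProductWith)
import Data.List as List
open import Data.List.Relation.Unary.All as All using (All; []; _∷_)
open import Data.List.Relation.Unary.All.Properties
  using (++⁺; ++⁻ˡ; ++⁻ʳ; map⁺; map⁻; tabulate⁻; cartesianProductWith⁺)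
open import Data.List.Relation.Unary.Any using (here; there)
open import Data.List.Membership.Propositional using (_∈_)
open import Data.List.Membership.Propositional.Properties using (∈-cartesianProductWith⁺)
import Data.List.Extrema as Extrema
open import Function using (_∘_; id; const; _⇔_; mk⇔; Equivalence)
open import Function.Construct.Composition using (_⇔-∘_)
open import Function.Construct.Symmetry using (⇔-sym)
open import Relation.Nullary using (¬_; Dec; yes; no)
open import Relation.Nullary.Decidable using (isYes; toWitness; fromWitness)
open import Relation.Unary using (Pred; _∩_; _∪_; _≐_)
open import Relation.Unary.Algebra using (∪-∩-isDistributiveLattice)
open import Relation.Binary using (Rel; IsDecTotalOrder; TotalOrder)
import Relation.Binary.PropositionalEquality as ≡
open ≡ using (_≡_)
import Relation.Binary.Reasoning.Setoid as SetoidReasoning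
import Relation.Binary.Properties.TotalOrder as TotalOrderProperties
import Relation.Binary.Lattice as Order
import Relation.Binary.Lattice.Properties.JoinSemilattice as JoinProperties
import Relation.Binary.Lattice.Properties.MeetSemilattice as MeetProperties
open import Algebra.Core using (Op₁; Op₂)
open import Algebra.Structures using (IsAbelianGroup)
open import Algebra.Bundles using (AbelianGroup)
open import Algebra.Bundles.Raw using (RawGroup)
open import Algebra.Morphism.Structures using (module GroupMorphisms)
import Algebra.Definitions.RawMonoid as RawMonoidDefinitions
import Algebra.Properties.AbelianGroup as AbelianGroupProperties
import Algebra.Properties.CommutativeSemigroup as CommutativeSemigroupProperties
import Algebra.Properties.CommutativeMonoid.Mult as CommutativeMonoidMult
import Algebra.Construct.Pointwise as PointwiseAlgebra
open import Algebra.Construct.NaturalChoice.Base using (MinOperator; MaxOperator)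
import Algebra.Construct.NaturalChoice.MinMaxOp as MinMaxOp
import Algebra.Lattice.Construct.NaturalChoice.MinMaxOp as MinMaxLattice
open import Algebra.Lattice.Structures using (IsLattice; IsDistributiveLattice)
open import Algebra.Lattice.Bundles using (Lattice)
import Algebra.Lattice.Properties.Lattice as LatticeProperties
import Algebra.Lattice.Construct.Subst.Equality as SubstEquality
open import Axiom.ExcludedMiddle using (ExcludedMiddle)
open import Defs

module LatticeOrder where

  module NaturalOrder {a ℓ : Level} {A : Set a} {_≈_ : Rel A ℓ} {_∨_ _∧_ : Op₂ A}
                      (isLattice : IsLattice _≈_ _∨_ _∧_) where

    private
      lattice : Lattice a ℓ
      lattice = record { isLattice = isLattice }

    open LatticeProperties lattice using (∨-∧-orderTheoreticLattice)
    open Order.Lattice ∨-∧-orderTheoreticLattice public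
      using (_≤_; x∧y≤x; x∧y≤y; ∧-greatest; x≤x∨y; y≤x∨y; ∨-least; antisym; ≤-respˡ-≈; ≤-respʳ-≈)
      renaming (refl to ≤-refl; trans to ≤-trans; reflexive to ≤-reflexive)
    open JoinProperties (Order.Lattice.joinSemilattice ∨-∧-orderTheoreticLattice) public
      using (∨-monotonic)
    open MeetProperties (Order.Lattice.meetSemilattice ∨-∧-orderTheoreticLattice) public
      using (∧-monotonic)
    open IsLattice isLattice using (sym)

    -- Defs writes the order of a lattice as  x ∧ y ≈ x ; the standard library as  x ≈ x ∧ y.
    ∧≈⇒≤ : ∀ {x y} → (x ∧ y) ≈ x → x ≤ y
    ∧≈⇒≤ = sym

    ≤⇒∧≈ : ∀ {x y} → x ≤ y → (x ∧ y) ≈ x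
    ≤⇒∧≈ = sym

  module DistributiveOrder {a ℓ : Level} {A : Set a} {_≈_ : Rel A ℓ} {_∨_ _∧_ : Op₂ A}
                           (isDistributiveLattice : IsDistributiveLattice _≈_ _∨_ _∧_) where

    open IsDistributiveLattice isDistributiveLattice
    open NaturalOrder isLattice public

    ∧-∨-cut : ∀ {x d w} → (x ∧ d) ≤ w → x ≤ (d ∨ w) → x ≤ w
    ∧-∨-cut {x} {d} {w} x∧d≤w x≤d∨w =
      ≤-trans (∧-greatest ≤-refl x≤d∨w)
              (≤-trans (≤-reflexive (∧-distribˡ-∨ x d w)) (∨-least x∧d≤w (x∧y≤y x w)))

    sequent-mono : ∀ {h h′ x x′ y y′ j j′} → h′ ≤ h → x′ ≤ x → y ≤ y′ → j ≤ j′ →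
                   (h ∧ x) ≤ (y ∨ j) → (h′ ∧ x′) ≤ (y′ ∨ j′)
    sequent-mono h′≤h x′≤x y≤y′ j≤j′ h∧x≤y∨j =
      ≤-trans (∧-monotonic h′≤h x′≤x) (≤-trans h∧x≤y∨j (∨-monotonic y≤y′ j≤j′))

    sequent-∧ʳ : ∀ {h x y y′ j} → (h ∧ x) ≤ (y ∨ j) → (h ∧ x) ≤ (y′ ∨ j) → (h ∧ x) ≤ ((y ∧ y′) ∨ j)
    sequent-∧ʳ {y = y} {y′} {j} p q = ≤-trans (∧-greatest p q) (≤-reflexive (sym (∨-distribʳ-∧ j y y′)))

    sequent-∨ˡ : ∀ {h x x′ y j} → (h ∧ x) ≤ (y ∨ j) → (h ∧ x′) ≤ (y ∨ j) → (h ∧ (x ∨ x′)) ≤ (y ∨ j)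
    sequent-∨ˡ {h} {x} {x′} p q = ≤-trans (≤-reflexive (∧-distribˡ-∨ h x x′)) (∨-least p q)

    sequent-cut : ∀ {h x y d j} → (h ∧ x) ≤ ((y ∨ d) ∨ j) → (h ∧ (x ∧ d)) ≤ (y ∨ j) → (h ∧ x) ≤ (y ∨ j)
    sequent-cut {h} {x} {y} {d} {j} p q = ∧-∨-cut (≤-respˡ-≈ (sym (∧-assoc h x d)) q) (≤-respʳ-≈ reassoc p)
      where
      reassoc : ((y ∨ d) ∨ j) ≈ (d ∨ (y ∨ j))
      reassoc = trans (∨-assoc y d j) (trans (∨-congˡ (∨-comm d j)) (trans (sym (∨-assoc y j d)) (∨-comm (y ∨ j) d)))

module AbelianGroupArithmetic {a ℓ : Level} {A : Set a} {_≈₀_ : Rel A ℓ} {_∙_ : Op₂ A} {ε : A} {_⁻¹ : Op₁ A}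
                              (isAbelianGroup : IsAbelianGroup _≈₀_ _∙_ ε _⁻¹) where

  abelianGroup : AbelianGroup a ℓ
  abelianGroup = record { isAbelianGroup = isAbelianGroup }

  open AbelianGroup abelianGroup public using (_≈_)

  -- the parameters above cannot carry fixities, hence these aliases
  infix  8 -_
  infixl 6 _+_

  _+_ : Op₂ A
  _+_ = _∙_

  -_ : Op₁ A
  -_ = _⁻¹

  0# : A
  0# = ε

  open IsAbelianGroup isAbelianGroup public
    using (refl; sym; trans; reflexive; setoid; assoc; comm; identityˡ; identityʳ; inverseˡ; inverseʳ)
    renaming (∙-cong to +-cong; ∙-congˡ to +-congˡ; ∙-congʳ to +-congʳ; ⁻¹-cong to -‿cong)
  open AbelianGroupProperties abelianGroup public
    using (x≈y⇒x∙y⁻¹≈ε)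
    renaming (⁻¹-involutive to -‿involutive; ε⁻¹≈ε to -0#≈0#; ⁻¹-anti-homo‿- to -‿anti-homo‿-)
  open AbelianGroupProperties abelianGroup using (⁻¹-∙-comm)
  open CommutativeSemigroupProperties (AbelianGroup.commutativeSemigroup abelianGroup) public
    using (interchange)
  open CommutativeMonoidMult (AbelianGroup.commutativeMonoid abelianGroup) public
    using ()
    renaming (_×_ to _·_; ×-homo-+ to ·-homo-+; ×-assocˡ to ·-assocˡ; ×-distrib-+ to ·-distrib-+;
              ×-congʳ to ·-congʳ; ×-congˡ to ·-congˡ)
  open SetoidReasoning setoid

  infixl 6 _-_
  _-_ : Op₂ A
  x - y = x + - y

  -‿distrib-+ : ∀ x y → - (x + y) ≈ - x + - y
  -‿distrib-+ x y = sym (⁻¹-∙-comm x y)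

  x-y+y≈x : ∀ x y → x - y + y ≈ x
  x-y+y≈x x y = begin
    x - y + y     ≈⟨ assoc x (- y) y ⟩
    x + (- y + y) ≈⟨ +-congˡ (inverseˡ y) ⟩
    x + 0#        ≈⟨ identityʳ x ⟩
    x             ∎

  x+y-y≈x : ∀ x y → x + y - y ≈ x
  x+y-y≈x x y = begin
    x + y - y     ≈⟨ assoc x y (- y) ⟩
    x + (y - y)   ≈⟨ +-congˡ (inverseʳ y) ⟩
    x + 0#        ≈⟨ identityʳ x ⟩
    x             ∎

  x+[-x+y]≈y : ∀ x y → x + (- x + y) ≈ y
  x+[-x+y]≈y x y = begin
    x + (- x + y) ≈⟨ sym (assoc x (- x) y) ⟩
    x - x + y     ≈⟨ +-congʳ (inverseʳ x) ⟩
    0# + y        ≈⟨ identityˡ y ⟩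
    y             ∎

  x+y-x≈y : ∀ x y → x + y - x ≈ y
  x+y-x≈y x y = trans (+-congʳ (comm x y)) (x+y-y≈x y x)

  x+[y-x]≈y : ∀ x y → x + (y - x) ≈ y
  x+[y-x]≈y x y = trans (comm x (y - x)) (x-y+y≈x y x)

  x-y≈[x-z]+[z-y] : ∀ x y z → x - y ≈ (x - z) + (z - y)
  x-y≈[x-z]+[z-y] x y z = sym (begin
    (x - z) + (z - y)   ≈⟨ assoc x (- z) (z - y) ⟩
    x + (- z + (z - y)) ≈⟨ +-congˡ (sym (assoc (- z) z (- y))) ⟩
    x + (- z + z - y)   ≈⟨ +-congˡ (+-congʳ (inverseˡ z)) ⟩
    x + (0# - y)        ≈⟨ +-congˡ (identityˡ (- y)) ⟩
    x - y               ∎)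

  [x+y]-[u+v]≈[x-u]+[y-v] : ∀ x y u v → (x + y) - (u + v) ≈ (x - u) + (y - v)
  [x+y]-[u+v]≈[x-u]+[y-v] x y u v = trans (+-congˡ (-‿distrib-+ u v)) (interchange x y (- u) (- v))

  -x--y≈y-x : ∀ x y → - x - - y ≈ y - x
  -x--y≈y-x x y = trans (+-congˡ (-‿involutive y)) (comm (- x) y)

  x+x≈x⇒x≈0 : ∀ {x} → x + x ≈ x → x ≈ 0#
  x+x≈x⇒x≈0 {x} x+x≈x = begin
    x          ≈⟨ sym (x+y-y≈x x x) ⟩
    x + x - x  ≈⟨ +-congʳ x+x≈x ⟩
    x - x      ≈⟨ inverseʳ x ⟩
    0#         ∎

  ·-zeroʳ : ∀ n → n · 0# ≈ 0#
  ·-zeroʳ zero    = refl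
  ·-zeroʳ (suc n) = trans (identityˡ (n · 0#)) (·-zeroʳ n)

  ·-distrib-neg : ∀ n x → n · (- x) ≈ - (n · x)
  ·-distrib-neg zero    x = sym -0#≈0#
  ·-distrib-neg (suc n) x = trans (+-congˡ (·-distrib-neg n x)) (sym (-‿distrib-+ x (n · x)))

  ·-distrib-- : ∀ n x y → n · (x - y) ≈ n · x - n · y
  ·-distrib-- n x y = trans (·-distrib-+ x (- y) n) (+-congˡ (·-distrib-neg n y))

  ·-comm : ∀ m n x → m · (n · x) ≈ n · (m · x)
  ·-comm m n x = begin
    m · (n · x)    ≈⟨ ·-assocˡ x m n ⟩
    (m *ℕ n) · x  ≈⟨ ·-congˡ (*-comm m n) ⟩
    (n *ℕ m) · x  ≈⟨ sym (·-assocˡ x n m) ⟩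
    n · (m · x)    ∎

module DOAGProperties {c ℓ : Level} (Γ : DOAG c ℓ) where

  open DOAG Γ public
  open AbelianGroupArithmetic isAbelianGroup public hiding (_≈_; _+_; -_; 0#)
  open IsDecTotalOrder isDecTotalOrder public
    using (_≤?_; total; antisym; ≤-respˡ-≈; ≤-respʳ-≈)
    renaming (refl to ≤-refl; trans to ≤-trans; reflexive to ≤-reflexive)

  totalOrder : TotalOrder c ℓ ℓ
  totalOrder = record { isTotalOrder = IsDecTotalOrder.isTotalOrder isDecTotalOrder }

  infix 4 _<_
  _<_ : Rel Carrier ℓ
  a < b = ¬ (b ≤ a)

  <⇒≤ : ∀ {a b} → a < b → a ≤ b
  <⇒≤ = TotalOrderProperties.≰⇒≥ totalOrder

  <-≤-trans : ∀ {a b d} → a < b → b ≤ d → a < d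
  <-≤-trans a<b b≤d d≤a = a<b (≤-trans b≤d d≤a)

  ≤-<-trans : ∀ {a b d} → a ≤ b → b < d → a < d
  ≤-<-trans a≤b b<d d≤a = b<d (≤-trans d≤a a≤b)

  <-respʳ-≈ : ∀ {a b d} → b ≈ d → a < b → a < d
  <-respʳ-≈ b≈d a<b d≤a = a<b (≤-respˡ-≈ (sym b≈d) d≤a)

  <-respˡ-≈ : ∀ {a b d} → a ≈ d → a < b → d < b
  <-respˡ-≈ a≈d a<b b≤d = a<b (≤-respʳ-≈ (sym a≈d) b≤d)

  min-operator : MinOperator (TotalOrder.totalPreorder totalOrder)
  min-operator = record { _⊓_ = min ; x≤y⇒x⊓y≈x = x≤y⇒min≈x ; x≥y⇒x⊓y≈y = y≤x⇒min≈y }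
    where
    x≤y⇒min≈x : ∀ {a b} → a ≤ b → min a b ≈ a
    x≤y⇒min≈x {a} {b} a≤b with a ≤? b
    ... | yes _  = refl
    ... | no a≰b = ⊥-elim (a≰b a≤b)
    y≤x⇒min≈y : ∀ {a b} → b ≤ a → min a b ≈ b
    y≤x⇒min≈y {a} {b} b≤a with a ≤? b
    ... | yes a≤b = antisym a≤b b≤a
    ... | no _    = refl

  max-operator : MaxOperator (TotalOrder.totalPreorder totalOrder)
  max-operator = record { _⊔_ = max ; x≤y⇒x⊔y≈y = x≤y⇒max≈y ; x≥y⇒x⊔y≈x = y≤x⇒max≈x }
    where
    x≤y⇒max≈y : ∀ {a b} → a ≤ b → max a b ≈ b
    x≤y⇒max≈y {a} {b} a≤b with a ≤? b
    ... | yes _  = refl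
    ... | no a≰b = ⊥-elim (a≰b a≤b)
    y≤x⇒max≈x : ∀ {a b} → b ≤ a → max a b ≈ a
    y≤x⇒max≈x {a} {b} b≤a with a ≤? b
    ... | yes a≤b = sym (antisym a≤b b≤a)
    ... | no _    = refl

  open MinMaxLattice min-operator max-operator public using (⊔-⊓-isLattice)
  open MinMaxOp min-operator max-operator public
    using (⊔-sel; x⊓y≤x; x⊓y≤y; ⊓-glb; x≤x⊔y; x≤y⊔x; x⊓y≈x⇒x≤y)
  open MinOperator min-operator public using (x≤y⇒x⊓y≈x; x≥y⇒x⊓y≈y)
  open MaxOperator max-operator public using (x≤y⇒x⊔y≈y; x≥y⇒x⊔y≈x)

  +-monoˡ-≤ : ∀ d {a b} → a ≤ b → a + d ≤ b + d
  +-monoˡ-≤ d {a} {b} = +-mono a b d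

  +-monoʳ-≤ : ∀ d {a b} → a ≤ b → d + a ≤ d + b
  +-monoʳ-≤ d {a} {b} a≤b = ≤-respˡ-≈ (comm a d) (≤-respʳ-≈ (comm b d) (+-monoˡ-≤ d a≤b))

  +-mono-≤ : ∀ {a b u v} → a ≤ b → u ≤ v → a + u ≤ b + v
  +-mono-≤ {b = b} {u} a≤b u≤v = ≤-trans (+-monoˡ-≤ u a≤b) (+-monoʳ-≤ b u≤v)

  +-cancelʳ-≤ : ∀ d {a b} → a + d ≤ b + d → a ≤ b
  +-cancelʳ-≤ d {a} {b} le = ≤-respˡ-≈ (x+y-y≈x a d) (≤-respʳ-≈ (x+y-y≈x b d) (+-monoˡ-≤ (- d) le))

  +-monoˡ-< : ∀ d {a b} → a < b → a + d < b + d
  +-monoˡ-< d a<b b+d≤a+d = a<b (+-cancelʳ-≤ d b+d≤a+d)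

  x≤y⇒0≤y-x : ∀ {a b} → a ≤ b → 0# ≤ b - a
  x≤y⇒0≤y-x {a} a≤b = ≤-respˡ-≈ (inverseʳ a) (+-monoˡ-≤ (- a) a≤b)

  0≤y-x⇒x≤y : ∀ {a b} → 0# ≤ b - a → a ≤ b
  0≤y-x⇒x≤y {a} {b} 0≤b-a = ≤-respˡ-≈ (identityˡ a) (≤-respʳ-≈ (x-y+y≈x b a) (+-monoˡ-≤ a 0≤b-a))

  x<y⇒0<y-x : ∀ {a b} → a < b → 0# < b - a
  x<y⇒0<y-x {a} {b} a<b b-a≤0 = a<b (≤-respˡ-≈ (x-y+y≈x b a) (≤-respʳ-≈ (identityˡ a) (+-monoˡ-≤ a b-a≤0)))

  0<y-x⇒x<y : ∀ {a b} → 0# < b - a → a < b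
  0<y-x⇒x<y {a} 0<b-a b≤a = 0<b-a (≤-respʳ-≈ (inverseʳ a) (+-monoˡ-≤ (- a) b≤a))

  neg-mono-≤ : ∀ {a b} → a ≤ b → - b ≤ - a
  neg-mono-≤ {a} {b} a≤b = 0≤y-x⇒x≤y (≤-respʳ-≈ (sym (-x--y≈y-x a b)) (x≤y⇒0≤y-x a≤b))

  0≤x⇒-x≤0 : ∀ {a} → 0# ≤ a → - a ≤ 0#
  0≤x⇒-x≤0 0≤a = ≤-respʳ-≈ -0#≈0# (neg-mono-≤ 0≤a)

  x≤0⇒0≤-x : ∀ {a} → a ≤ 0# → 0# ≤ - a
  x≤0⇒0≤-x a≤0 = ≤-respˡ-≈ -0#≈0# (neg-mono-≤ a≤0)

  ·-nonPos : ∀ n {a} → a ≤ 0# → n · a ≤ 0#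
  ·-nonPos zero    a≤0 = ≤-refl
  ·-nonPos (suc n) a≤0 = ≤-respʳ-≈ (identityˡ 0#) (+-mono-≤ a≤0 (·-nonPos n a≤0))

  ·-cancel-nonNeg : ∀ n {a} → 0# ≤ suc n · a → 0# ≤ a
  ·-cancel-nonNeg n {a} 0≤na with total 0# a
  ... | inj₁ 0≤a = 0≤a
  ... | inj₂ a≤0 = ≤-trans 0≤na (≤-respʳ-≈ (identityʳ a) (+-monoʳ-≤ a (·-nonPos n a≤0)))

  ·-cancel-pos : ∀ n {a} → 0# < suc n · a → 0# < a
  ·-cancel-pos n 0<na a≤0 = 0<na (·-nonPos (suc n) a≤0)

  times≈· : ∀ n b → times _+_ 0# n b ≈ n · b
  times≈· zero    b = refl
  times≈· (suc n) b = +-congˡ (times≈· n b)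

  divide : ∀ n a → ∃ λ b → suc n · b ≈ a
  divide n a with divisible n a
  ... | b , nb≈a = b , trans (sym (times≈· (suc n) b)) nb≈a

  negative : ∃ λ a → a < 0#
  negative with nontrivial
  ... | a , a≉0 with a ≤? 0#
  ...   | yes a≤0 = a , λ 0≤a → a≉0 (antisym a≤0 0≤a)
  ...   | no  a≰0 = - a , λ 0≤-a → a≰0 (≤-respˡ-≈ (-‿involutive a) (≤-respʳ-≈ -0#≈0# (neg-mono-≤ 0≤-a)))

module ValuedLGroup where

  open LatticeOrder using (module NaturalOrder; module DistributiveOrder)

  groupSort : ∀ {gc ge lc le} → VLStructure gc ge lc le → RawGroup gc ge
  groupSort S = record { Carrier = G ; _≈_ = _≈G_ ; _∙_ = _+_ ; ε = 0G ; _⁻¹ = -_ }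
    where open VLStructure S

  module Notation {gc ge lc le : Level} (S : VLStructure gc ge lc le) where

    open VLStructure S public using (G; L; _≈G_; _≈L_; ⊥L; ⊤L; P)

    -- VLStructure declares no fixities for its operations
    infixr 7 _∧_ _⊓_
    infixr 6 _∨_ _⊔_

    _∧_ _∨_ : Op₂ G
    _∧_ = VLStructure._∧_ S
    _∨_ = VLStructure._∨_ S

    _⊓_ _⊔_ : Op₂ L
    _⊓_ = VLStructure._⊓_ S
    _⊔_ = VLStructure._⊔L_ S

  module Properties {gc ge lc le : Level} {S : VLStructure gc ge lc le} (isValuedLGroup : IsValuedLGroup S) where

    open Notation S
    open IsValuedLGroup isValuedLGroup public
    open AbelianGroupArithmetic isAbelianGroup public hiding (_≈_)
    module Gₒ = NaturalOrder isLattice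
    module Lₒ = DistributiveOrder isDistributiveLattice
    module Gₑ = IsLattice isLattice
    module Lₑ = IsDistributiveLattice isDistributiveLattice
    open Gₒ public using (_≤_)
    open Lₒ public using () renaming (_≤_ to _⊑_)
    open SetoidReasoning setoid

    +-monoˡ-≤ : ∀ d {a b} → a ≤ b → a + d ≤ b + d
    +-monoˡ-≤ d {a} {b} a≤b = Gₒ.∧≈⇒≤ (+-mono a b d (Gₒ.≤⇒∧≈ a≤b))

    +-monoʳ-≤ : ∀ d {a b} → a ≤ b → d + a ≤ d + b
    +-monoʳ-≤ d {a} {b} a≤b = Gₒ.≤-respʳ-≈ (comm b d) (Gₒ.≤-respˡ-≈ (comm a d) (+-monoˡ-≤ d a≤b))

    x≤y⇒0≤y-x : ∀ {a b} → a ≤ b → 0# ≤ b - a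
    x≤y⇒0≤y-x {a} a≤b = Gₒ.≤-respˡ-≈ (inverseʳ a) (+-monoˡ-≤ (- a) a≤b)

    -‿antimono-≤ : ∀ {a b} → a ≤ b → - b ≤ - a
    -‿antimono-≤ {a} {b} a≤b =
      Gₒ.≤-respˡ-≈ (x+[-x+y]≈y a (- b)) (Gₒ.≤-respʳ-≈ b+[-a-b]≈-a (+-monoˡ-≤ (- a + - b) a≤b))
      where
      b+[-a-b]≈-a : b + (- a + - b) ≈G - a
      b+[-a-b]≈-a = trans (+-congˡ (comm (- a) (- b))) (x+[-x+y]≈y b (- a))

    +-distribˡ-∧ : ∀ d a b → d + (a ∧ b) ≈G (d + a) ∧ (d + b)
    +-distribˡ-∧ d a b = Gₒ.antisym
      (Gₒ.∧-greatest (+-monoʳ-≤ d (Gₒ.x∧y≤x a b)) (+-monoʳ-≤ d (Gₒ.x∧y≤y a b)))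
      (shift (Gₒ.∧-greatest (unshift (Gₒ.x∧y≤x _ _)) (unshift (Gₒ.x∧y≤y _ _))))
      where
      unshift : ∀ {m u} → m ≤ d + u → m - d ≤ u
      unshift {m} {u} m≤d+u = Gₒ.≤-respʳ-≈ (x+y-x≈y d u) (+-monoˡ-≤ (- d) m≤d+u)
      shift : ∀ {m u} → m - d ≤ u → m ≤ d + u
      shift {m} {u} m-d≤u = Gₒ.≤-respˡ-≈ (x-y+y≈x m d) (Gₒ.≤-respʳ-≈ (comm u d) (+-monoˡ-≤ d m-d≤u))

    x≤-y⇒y≤-x : ∀ {a b} → a ≤ - b → b ≤ - a
    x≤-y⇒y≤-x {a} {b} a≤-b = Gₒ.≤-respˡ-≈ (-‿involutive b) (-‿antimono-≤ a≤-b)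

    -‿distrib-∨ : ∀ a b → - (a ∨ b) ≈G - a ∧ - b
    -‿distrib-∨ a b = Gₒ.antisym
      (Gₒ.∧-greatest (-‿antimono-≤ (Gₒ.x≤x∨y a b)) (-‿antimono-≤ (Gₒ.y≤x∨y a b)))
      (x≤-y⇒y≤-x (Gₒ.∨-least (x≤-y⇒y≤-x (Gₒ.x∧y≤x (- a) (- b))) (x≤-y⇒y≤-x (Gₒ.x∧y≤y (- a) (- b)))))

    -- t ∧ 0 is idempotent for t = a ∨ - a, hence zero
    0≤x∨-x : ∀ a → 0# ≤ a ∨ - a
    0≤x∨-x a = trans (sym s≈0) (∧-comm t 0#)
      where
      t = a ∨ - a
      s = t ∧ 0#
      open Gₑ using (∧-comm; ∧-congˡ)
      -t≤t : - t ≤ t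
      -t≤t = Gₒ.≤-trans (Gₒ.≤-respˡ-≈ (sym (-‿distrib-∨ a (- a))) (Gₒ.x∧y≤y (- a) (- - a)))
                        (Gₒ.≤-respˡ-≈ (sym (-‿involutive a)) (Gₒ.x≤x∨y a (- a)))
      s≤t+t : s ≤ t + t
      s≤t+t = Gₒ.≤-trans (Gₒ.x∧y≤y t 0#) (Gₒ.≤-respˡ-≈ (inverseˡ t) (+-monoˡ-≤ t -t≤t))
      s≤s+t : s ≤ s + t
      s≤s+t = Gₒ.≤-respʳ-≈ (trans (sym (+-distribˡ-∧ t t 0#)) (comm t s))
                (Gₒ.∧-greatest s≤t+t (Gₒ.≤-respʳ-≈ (sym (identityʳ t)) (Gₒ.x∧y≤x t 0#)))
      s+s≈s : s + s ≈G s
      s+s≈s = begin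
        s + s               ≈⟨ +-distribˡ-∧ s t 0# ⟩
        (s + t) ∧ (s + 0#)  ≈⟨ ∧-congˡ (identityʳ s) ⟩
        (s + t) ∧ s         ≈⟨ ∧-comm (s + t) s ⟩
        s ∧ (s + t)         ≈⟨ sym s≤s+t ⟩
        s                   ∎
      s≈0 : s ≈G 0#
      s≈0 = x+x≈x⇒x≈0 s+s≈s

    [x∧y]-x≈0∧[y-x] : ∀ a b → (a ∧ b) - a ≈G 0# ∧ (b - a)
    [x∧y]-x≈0∧[y-x] a b = begin
      (a ∧ b) - a               ≈⟨ comm (a ∧ b) (- a) ⟩
      - a + (a ∧ b)             ≈⟨ +-distribˡ-∧ (- a) a b ⟩
      (- a + a) ∧ (- a + b)     ≈⟨ Gₑ.∧-cong (inverseˡ a) (comm (- a) b) ⟩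
      0# ∧ (b - a)              ∎

    x-[x∨y]≈0∧[x-y] : ∀ a b → a - (a ∨ b) ≈G 0# ∧ (a - b)
    x-[x∨y]≈0∧[x-y] a b = begin
      a - (a ∨ b)               ≈⟨ +-congˡ (-‿distrib-∨ a b) ⟩
      a + (- a ∧ - b)           ≈⟨ +-distribˡ-∧ a (- a) (- b) ⟩
      (a - a) ∧ (a - b)         ≈⟨ Gₑ.∧-congʳ (inverseʳ a) ⟩
      0# ∧ (a - b)              ∎

    P-mono : ∀ {a b} → a ≤ b → P a ⊑ P b
    P-mono {a} {b} a≤b = Lₑ.trans (P-cong a≤b) (P-∧ a b)

    x⊑⊤ : ∀ l → l ⊑ ⊤L
    x⊑⊤ l = Lₑ.sym (Lₑ.trans (Lₑ.∧-comm l ⊤L) (⊤-identity l))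

    ⊥⊑x : ∀ l → ⊥L ⊑ l
    ⊥⊑x l = Lₒ.≤-respʳ-≈ (⊥-identity l) (Lₒ.x≤x∨y ⊥L l)

    0≤x⇒⊤⊑P : ∀ {a} → 0# ≤ a → ⊤L ⊑ P a
    0≤x⇒⊤⊑P 0≤a = Lₒ.≤-respˡ-≈ P-0 (P-mono 0≤a)

    P[0∧x]≈P : ∀ a → P (0# ∧ a) ≈L P a
    P[0∧x]≈P a = Lₑ.trans (P-∧ 0# a) (Lₑ.trans (Lₑ.∧-congʳ P-0) (⊤-identity (P a)))

    ⊤⊑P⊔P- : ∀ a → ⊤L ⊑ P a ⊔ P (- a)
    ⊤⊑P⊔P- a = Lₒ.≤-respʳ-≈ (P-∨ a (- a)) (0≤x⇒⊤⊑P (0≤x∨-x a))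

module StanValued {c ℓ x : Level} (Γ : DOAG c ℓ) (X : Set x) where

  open DOAGProperties Γ
  open VLStructure (Stan Γ X) using (_≈G_; _∧_; _∨_; _≈L_)

  ∨-∧-isLattice : IsLattice _≈G_ _∨_ _∧_
  ∨-∧-isLattice = record
    { isEquivalence = PointwiseAlgebra.isEquivalence X isEquivalence
    ; ∨-comm     = λ f g i → ∨-comm (f i) (g i)
    ; ∨-assoc    = λ f g h i → ∨-assoc (f i) (g i) (h i)
    ; ∨-cong     = λ f≈f′ g≈g′ i → ∨-cong (f≈f′ i) (g≈g′ i)
    ; ∧-comm     = λ f g i → ∧-comm (f i) (g i)
    ; ∧-assoc    = λ f g h i → ∧-assoc (f i) (g i) (h i)
    ; ∧-cong     = λ f≈f′ g≈g′ i → ∧-cong (f≈f′ i) (g≈g′ i)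
    ; absorptive = (λ f g i → proj₁ absorptive (f i) (g i)) , (λ f g i → proj₂ absorptive (f i) (g i))
    }
    where open IsLattice ⊔-⊓-isLattice

  ∪-∩-isDistributiveLattice′ : IsDistributiveLattice _≈L_ _∪_ _∩_
  ∪-∩-isDistributiveLattice′ = SubstEquality.isDistributiveLattice (≐⇒≈L , ≈L⇒≐) (∪-∩-isDistributiveLattice X ℓ)
    where
    ≐⇒≈L : ∀ {S T : Pred X ℓ} → S ≐ T → S ≈L T
    ≐⇒≈L (S⊆T , T⊆S) i = mk⇔ S⊆T T⊆S
    ≈L⇒≐ : ∀ {S T : Pred X ℓ} → S ≈L T → S ≐ T
    ≈L⇒≐ S≈T = (λ {i} → Equivalence.to (S≈T i)) , (λ {i} → Equivalence.from (S≈T i))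

  0≤max⇒0≤⊎0≤ : ∀ a b → 0# ≤ max a b → 0# ≤ a ⊎ 0# ≤ b
  0≤max⇒0≤⊎0≤ a b 0≤a∨b with ⊔-sel a b
  ... | inj₁ a∨b≈a = inj₁ (≤-respʳ-≈ a∨b≈a 0≤a∨b)
  ... | inj₂ a∨b≈b = inj₂ (≤-respʳ-≈ a∨b≈b 0≤a∨b)

  indicator : {S : Set ℓ} → Dec S → Carrier
  indicator (yes _) = 0#
  indicator (no _)  = proj₁ negative

  0≤indicator⇔ : ∀ {S : Set ℓ} (S? : Dec S) → (0# ≤ indicator S?) ⇔ S
  0≤indicator⇔ (yes s)  = mk⇔ (λ _ → s) (λ _ → ≤-refl)
  0≤indicator⇔ (no ¬s)  = mk⇔ (λ 0≤neg → ⊥-elim (proj₂ negative 0≤neg)) (λ s → ⊥-elim (¬s s))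

  stan-isDenselyValued : ExcludedMiddle ℓ → IsDenselyValuedLGroup (Stan Γ X)
  stan-isDenselyValued em = record
    { isValuedLGroup = record
      { isAbelianGroup        = PointwiseAlgebra.isAbelianGroup X isAbelianGroup
      ; isLattice             = ∨-∧-isLattice
      ; +-mono                = λ f g h f≤g i → x≤y⇒x⊓y≈x (+-monoˡ-≤ (h i) (x⊓y≈x⇒x≤y (f≤g i)))
      ; isDistributiveLattice = ∪-∩-isDistributiveLattice′
      ; ⊥-identity            = λ S i → mk⇔ (λ { (inj₁ (lift ())) ; (inj₂ s) → s }) inj₂
      ; ⊤-identity            = λ S i → mk⇔ proj₂ (λ s → lift tt , s)
      ; P-cong                = λ f≈g i → mk⇔ (≤-respʳ-≈ (f≈g i)) (≤-respʳ-≈ (sym (f≈g i)))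
      ; P-∧                   = λ f g i → mk⇔ (λ 0≤f∧g → ≤-trans 0≤f∧g (x⊓y≤x _ _) , ≤-trans 0≤f∧g (x⊓y≤y _ _))
                                              (λ (0≤f , 0≤g) → ⊓-glb 0≤f 0≤g)
      ; P-∨                   = λ f g i → mk⇔ (0≤max⇒0≤⊎0≤ (f i) (g i))
                                              (λ { (inj₁ 0≤f) → ≤-trans 0≤f (x≤x⊔y _ _) ; (inj₂ 0≤g) → ≤-trans 0≤g (x≤y⊔x _ _) })
      ; P-0                   = λ i → mk⇔ (λ _ → lift tt) (λ _ → ≤-refl)
      ; P-+                   = λ f g i → mk⇔ proj₁ (λ (0≤f , 0≤g) → (0≤f , 0≤g) , ≤-respˡ-≈ (identityˡ 0#) (+-mono-≤ 0≤f 0≤g))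
      ; P-onto                = λ S _ → (λ i → indicator (em {S i})) , (λ i → 0≤indicator⇔ (em {S i}))
      }
    ; dense = λ f P≈⊤ i → x≤y⇒x⊓y≈x (Equivalence.from (P≈⊤ i) (lift tt))
    }

module FourierMotzkin where

  -- (p , q) stands for the integer coefficient p - q
  Coefficient : Set
  Coefficient = ℕ × ℕ

  data Strictness : Set where
    weak strict : Strictness

  infixr 6 _∨ₛ_
  _∨ₛ_ : Strictness → Strictness → Strictness
  weak   ∨ₛ κ = κ
  strict ∨ₛ _ = strict

  -- the sign conditions a ≥ 0 and a > 0 of an ordered group, axiomatised as far as Fourier–Motzkin needs them
  record Positivity {a ℓ : Level} (A : AbelianGroup a ℓ) (q : Level) : Set (a ⊔ℓ ℓ ⊔ℓ lsuc q) where
    open AbelianGroupArithmetic (AbelianGroup.isAbelianGroup A)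
    field
      NonNeg Pos  : AbelianGroup.Carrier A → Set q
      NonNeg-resp : ∀ {x y} → x ≈ y → NonNeg x → NonNeg y
      Pos-resp    : ∀ {x y} → x ≈ y → Pos x → Pos y
      NonNeg-0    : NonNeg 0#
      NonNeg-+    : ∀ {x y} → NonNeg x → NonNeg y → NonNeg (x + y)
      Pos-+       : ∀ {x y} → Pos x → NonNeg y → Pos (x + y)
      Pos⇒NonNeg  : ∀ {x} → Pos x → NonNeg x

    IsPositive : Strictness → AbelianGroup.Carrier A → Set q
    IsPositive weak   = NonNeg
    IsPositive strict = Pos

    IsPositive-resp : ∀ κ {x y} → x ≈ y → IsPositive κ x → IsPositive κ y
    IsPositive-resp weak   = NonNeg-resp
    IsPositive-resp strict = Pos-resp

    NonNeg-· : ∀ n {x} → NonNeg x → NonNeg (n · x)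
    NonNeg-· zero    _     = NonNeg-0
    NonNeg-· (suc n) 0≤x   = NonNeg-+ 0≤x (NonNeg-· n 0≤x)

    IsPositive-· : ∀ κ n {x} → IsPositive κ x → IsPositive κ (suc n · x)
    IsPositive-· weak   n 0≤x = NonNeg-· (suc n) 0≤x
    IsPositive-· strict n 0<x = Pos-+ 0<x (NonNeg-· n (Pos⇒NonNeg 0<x))

    IsPositive-+ : ∀ κ κ′ {x y} → IsPositive κ x → IsPositive κ′ y → IsPositive (κ ∨ₛ κ′) (x + y)
    IsPositive-+ weak   weak   0≤x 0≤y = NonNeg-+ 0≤x 0≤y
    IsPositive-+ weak   strict 0≤x 0<y = Pos-resp (comm _ _) (Pos-+ 0<y 0≤x)
    IsPositive-+ strict weak   0<x 0≤y = Pos-+ 0<x 0≤y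
    IsPositive-+ strict strict 0<x 0<y = Pos-+ 0<x (Pos⇒NonNeg 0<y)

    infix 4 _≃_
    _≃_ : AbelianGroup.Carrier A → AbelianGroup.Carrier A → Set q
    x ≃ y = NonNeg (x - y) × NonNeg (y - x)

    ≈⇒≃ : ∀ {x y} → x ≈ y → x ≃ y
    ≈⇒≃ x≈y = NonNeg-resp (sym (x≈y⇒x∙y⁻¹≈ε x≈y)) NonNeg-0 , NonNeg-resp (sym (x≈y⇒x∙y⁻¹≈ε (sym x≈y))) NonNeg-0

    ≃-trans : ∀ {x y z} → x ≃ y → y ≃ z → x ≃ z
    ≃-trans {x} {y} {z} (x≥y , y≥x) (y≥z , z≥y) =
      NonNeg-resp (sym (x-y≈[x-z]+[z-y] x z y)) (NonNeg-+ x≥y y≥z) ,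
      NonNeg-resp (sym (x-y≈[x-z]+[z-y] z x y)) (NonNeg-+ z≥y y≥x)

    ≃-+ : ∀ {x x′ y y′} → x ≃ x′ → y ≃ y′ → x + y ≃ x′ + y′
    ≃-+ {x} {x′} {y} {y′} (x≥x′ , x′≥x) (y≥y′ , y′≥y) =
      NonNeg-resp (sym ([x+y]-[u+v]≈[x-u]+[y-v] x y x′ y′)) (NonNeg-+ x≥x′ y≥y′) ,
      NonNeg-resp (sym ([x+y]-[u+v]≈[x-u]+[y-v] x′ y′ x y)) (NonNeg-+ x′≥x y′≥y)

    ≃-‿ : ∀ {x x′} → x ≃ x′ → - x ≃ - x′
    ≃-‿ {x} {x′} (x≥x′ , x′≥x) = NonNeg-resp (sym (-x--y≈y-x x x′)) x′≥x , NonNeg-resp (sym (-x--y≈y-x x′ x)) x≥x′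

    NonNeg-≃ : ∀ {x x′} → x ≃ x′ → NonNeg x → NonNeg x′
    NonNeg-≃ {x} {x′} (_ , x′≥x) 0≤x = NonNeg-resp (x+[y-x]≈y x x′) (NonNeg-+ 0≤x x′≥x)

    Pos-≃ : ∀ {x x′} → x ≃ x′ → Pos x → Pos x′
    Pos-≃ {x} {x′} (_ , x′≥x) 0<x = Pos-resp (x+[y-x]≈y x x′) (Pos-+ 0<x x′≥x)

    IsPositive-≃ : ∀ κ {x x′} → x ≃ x′ → IsPositive κ x → IsPositive κ x′
    IsPositive-≃ weak   = NonNeg-≃
    IsPositive-≃ strict = Pos-≃

  module Forms {p p′ : Level} (Par : RawGroup p p′) where

    open RawGroup Par using () renaming (Carrier to Parameter; _∙_ to _⊕_; ε to 𝟘; _⁻¹ to ⊖_)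
    open RawMonoidDefinitions (RawGroup.rawMonoid Par) using () renaming (_×_ to _⊙_)

    -- the affine form  Σⱼ (pⱼ - qⱼ) xⱼ + c
    LinearForm : ℕ → Set p
    LinearForm k = Vec Coefficient k × Parameter

    -- a constraint  f ≥ 0  (weak) or  f > 0  (strict)
    Constraint : ℕ → Set p
    Constraint k = LinearForm k × Strictness

    infixl 6 _+ᶠ_ _-ᶠ_
    infix  8 -ᶠ_
    infixr 7 _·ᶠ_

    constant : ∀ {k} → Parameter → LinearForm k
    constant c = Vec.replicate _ (0 , 0) , c

    unitVector : ∀ {k} → Fin k → Vec Coefficient k
    unitVector zero    = (1 , 0) ∷ Vec.replicate _ (0 , 0)
    unitVector (suc j) = (0 , 0) ∷ unitVector j

    coordinate : ∀ {k} → Fin k → LinearForm k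
    coordinate j = unitVector j , 𝟘

    _+ᶠ_ : ∀ {k} → LinearForm k → LinearForm k → LinearForm k
    (cs , c) +ᶠ (ds , d) = Vec.zipWith (λ (p , q) (p′ , q′) → p +ℕ p′ , q +ℕ q′) cs ds , c ⊕ d

    -ᶠ_ : ∀ {k} → LinearForm k → LinearForm k
    -ᶠ (cs , c) = Vec.map swap cs , ⊖ c

    _-ᶠ_ : ∀ {k} → LinearForm k → LinearForm k → LinearForm k
    f -ᶠ g = f +ᶠ -ᶠ g

    _·ᶠ_ : ∀ {k} → ℕ → LinearForm k → LinearForm k
    n ·ᶠ (cs , c) = Vec.map (λ (p , q) → n *ℕ p , n *ℕ q) cs , n ⊙ c

    -- the constraint  (suc multiplicity) x + rest ⋈ 0  (a lower bound on x)
    -- or  - (suc multiplicity) x + rest ⋈ 0  (an upper bound)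
    record Bound (k : ℕ) : Set p where
      constructor bound
      field
        multiplicity : ℕ
        rest         : LinearForm k
        strictness   : Strictness

    data Shape {k : ℕ} : Constraint (suc k) → Set p where
      independent : ∀ p cs c κ   → Shape (((p , p) ∷ cs , c) , κ)
      lowerBound  : ∀ q d cs c κ → Shape (((suc (q +ℕ d) , q) ∷ cs , c) , κ)
      upperBound  : ∀ p d cs c κ → Shape (((p , suc (p +ℕ d)) ∷ cs , c) , κ)

    shape : ∀ {k} (c : Constraint (suc k)) → Shape c
    shape (((p , q) ∷ cs , c) , κ) with compare p q
    ... | less    .p d = upperBound p d cs c κ
    ... | equal   .p   = independent p cs c κ
    ... | greater .q d = lowerBound q d cs c κ

    record Partition (k : ℕ) : Set p where
      constructor ⟨_,_,_⟩
      field
        independents : List (Constraint k)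
        lowers uppers : List (Bound k)
    open Partition public

    insert : ∀ {k} {c : Constraint (suc k)} → Shape c → Partition k → Partition k
    insert (independent p cs c κ) ⟨ is , ls , us ⟩ = ⟨ ((cs , c) , κ) ∷ is , ls , us ⟩
    insert (lowerBound q d cs c κ)  ⟨ is , ls , us ⟩ = ⟨ is , bound d (cs , c) κ ∷ ls , us ⟩
    insert (upperBound p d cs c κ)  ⟨ is , ls , us ⟩ = ⟨ is , ls , bound d (cs , c) κ ∷ us ⟩

    partition : ∀ {k} → List (Constraint (suc k)) → Partition k
    partition []       = ⟨ [] , [] , [] ⟩
    partition (c ∷ cs) = insert (shape c) (partition cs)

    combine : ∀ {k} → Bound k → Bound k → Constraint k
    combine (bound a r κ) (bound b r′ κ′) = suc b ·ᶠ r +ᶠ suc a ·ᶠ r′ , κ ∨ₛ κ′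

    eliminate : ∀ {k} → List (Constraint (suc k)) → List (Constraint k)
    eliminate cs = independents P ++ cartesianProductWith combine (lowers P) (uppers P)
      where P = partition cs

  module Semantics {p p′ a ℓ : Level} (Par : RawGroup p p′) (A : AbelianGroup a ℓ)
                   (π : RawGroup.Carrier Par → AbelianGroup.Carrier A)
                   (π-isHomomorphism : GroupMorphisms.IsGroupHomomorphism Par (AbelianGroup.rawGroup A) π) where

    open Forms Par
    open RawGroup Par using () renaming (_∙_ to _⊕_; ε to 𝟘; _⁻¹ to ⊖_)
    open RawMonoidDefinitions (RawGroup.rawMonoid Par) using () renaming (_×_ to _⊙_)
    open GroupMorphisms.IsGroupHomomorphism π-isHomomorphism using (homo; ε-homo; ⁻¹-homo)
    open AbelianGroupArithmetic (AbelianGroup.isAbelianGroup A)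
    open SetoidReasoning setoid
    open AbelianGroup A using (Carrier)

    term : Coefficient → Carrier → Carrier
    term (p , q) x = p · x - q · x

    ⟦_⟧ : ∀ {k} → LinearForm k → Vec Carrier k → Carrier
    ⟦ []       , c ⟧ []       = π c
    ⟦ (t ∷ ts) , c ⟧ (x ∷ xs) = term t x + ⟦ ts , c ⟧ xs

    π-⊙ : ∀ n c → π (n ⊙ c) ≈ n · π c
    π-⊙ zero    c = ε-homo
    π-⊙ (suc n) c = trans (homo c (n ⊙ c)) (+-congˡ (π-⊙ n c))

    term-zero : ∀ p x → term (p , p) x ≈ 0#
    term-zero p x = inverseʳ (p · x)

    term-+ : ∀ p q p′ q′ x → term (p +ℕ p′ , q +ℕ q′) x ≈ term (p , q) x + term (p′ , q′) x
    term-+ p q p′ q′ x = begin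
      (p +ℕ p′) · x - (q +ℕ q′) · x        ≈⟨ +-cong (·-homo-+ x p p′) (-‿cong (·-homo-+ x q q′)) ⟩
      (p · x + p′ · x) - (q · x + q′ · x)  ≈⟨ [x+y]-[u+v]≈[x-u]+[y-v] (p · x) (p′ · x) (q · x) (q′ · x) ⟩
      term (p , q) x + term (p′ , q′) x    ∎

    term-swap : ∀ p q x → term (q , p) x ≈ - term (p , q) x
    term-swap p q x = sym (-‿anti-homo‿- (p · x) (q · x))

    term-· : ∀ n p q x → term (n *ℕ p , n *ℕ q) x ≈ n · term (p , q) x
    term-· n p q x = begin
      (n *ℕ p) · x - (n *ℕ q) · x  ≈⟨ +-cong (sym (·-assocˡ x n p)) (-‿cong (sym (·-assocˡ x n q))) ⟩
      n · (p · x) - n · (q · x)    ≈⟨ sym (·-distrib-- n (p · x) (q · x)) ⟩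
      n · term (p , q) x           ∎

    term-lower : ∀ q d x → term (suc (q +ℕ d) , q) x ≈ suc d · x
    term-lower q d x = begin
      suc (q +ℕ d) · x - q · x    ≈⟨ +-congʳ (·-congˡ (≡.sym (+-suc q d))) ⟩
      (q +ℕ suc d) · x - q · x    ≈⟨ +-congʳ (·-homo-+ x q (suc d)) ⟩
      q · x + suc d · x - q · x   ≈⟨ x+y-x≈y (q · x) (suc d · x) ⟩
      suc d · x                   ∎

    term-upper : ∀ p d x → term (p , suc (p +ℕ d)) x ≈ - (suc d · x)
    term-upper p d x = trans (term-swap (suc (p +ℕ d)) p x) (-‿cong (term-lower p d x))

    ⟦+ᶠ⟧ : ∀ {k} (f g : LinearForm k) xs → ⟦ f +ᶠ g ⟧ xs ≈ ⟦ f ⟧ xs + ⟦ g ⟧ xs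
    ⟦+ᶠ⟧ ([] , c) ([] , d) [] = homo c d
    ⟦+ᶠ⟧ ((p , q) ∷ ts , c) ((p′ , q′) ∷ us , d) (x ∷ xs) = begin
      term (p +ℕ p′ , q +ℕ q′) x + ⟦ (ts , c) +ᶠ (us , d) ⟧ xs
        ≈⟨ +-cong (term-+ p q p′ q′ x) (⟦+ᶠ⟧ (ts , c) (us , d) xs) ⟩
      (term (p , q) x + term (p′ , q′) x) + (⟦ ts , c ⟧ xs + ⟦ us , d ⟧ xs)
        ≈⟨ interchange _ _ _ _ ⟩
      (term (p , q) x + ⟦ ts , c ⟧ xs) + (term (p′ , q′) x + ⟦ us , d ⟧ xs) ∎

    ⟦-ᶠ⟧ : ∀ {k} (f : LinearForm k) xs → ⟦ -ᶠ f ⟧ xs ≈ - ⟦ f ⟧ xs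
    ⟦-ᶠ⟧ ([] , c) [] = ⁻¹-homo c
    ⟦-ᶠ⟧ ((p , q) ∷ ts , c) (x ∷ xs) =
      trans (+-cong (term-swap p q x) (⟦-ᶠ⟧ (ts , c) xs)) (sym (-‿distrib-+ _ _))

    ⟦f-ᶠg⟧ : ∀ {k} (f g : LinearForm k) xs → ⟦ f -ᶠ g ⟧ xs ≈ ⟦ f ⟧ xs - ⟦ g ⟧ xs
    ⟦f-ᶠg⟧ f g xs = trans (⟦+ᶠ⟧ f (-ᶠ g) xs) (+-congˡ (⟦-ᶠ⟧ g xs))

    ⟦·ᶠ⟧ : ∀ {k} n (f : LinearForm k) xs → ⟦ n ·ᶠ f ⟧ xs ≈ n · ⟦ f ⟧ xs
    ⟦·ᶠ⟧ n ([] , c) [] = π-⊙ n c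
    ⟦·ᶠ⟧ n ((p , q) ∷ ts , c) (x ∷ xs) =
      trans (+-cong (term-· n p q x) (⟦·ᶠ⟧ n (ts , c) xs)) (sym (·-distrib-+ _ _ n))

    ⟦constant⟧ : ∀ {k} c (xs : Vec Carrier k) → ⟦ constant c ⟧ xs ≈ π c
    ⟦constant⟧ c []       = refl
    ⟦constant⟧ c (x ∷ xs) = trans (+-cong (term-zero 0 x) (⟦constant⟧ c xs)) (identityˡ (π c))

    ⟦coordinate⟧ : ∀ {k} (j : Fin k) xs → ⟦ coordinate j ⟧ xs ≈ Vec.lookup xs j
    ⟦coordinate⟧ zero    (x ∷ xs) = begin
      term (1 , 0) x + ⟦ constant 𝟘 ⟧ xs  ≈⟨ +-cong (trans (+-cong (identityʳ x) -0#≈0#) (identityʳ x)) (⟦constant⟧ 𝟘 xs) ⟩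
      x + π 𝟘                             ≈⟨ trans (+-congˡ ε-homo) (identityʳ x) ⟩
      x                                   ∎
    ⟦coordinate⟧ (suc j) (x ∷ xs) = trans (+-cong (term-zero 0 x) (⟦coordinate⟧ j xs)) (identityˡ _)

    ⟦combine⟧ : ∀ {k} a b (r r′ : LinearForm k) x xs →
                ⟦ suc b ·ᶠ r +ᶠ suc a ·ᶠ r′ ⟧ xs ≈ suc b · (suc a · x + ⟦ r ⟧ xs) + suc a · (- (suc b · x) + ⟦ r′ ⟧ xs)
    ⟦combine⟧ a b r r′ x xs = sym (begin
      b⁺ · (a⁺ · x + R) + a⁺ · (- (b⁺ · x) + R′)               ≈⟨ +-cong (·-distrib-+ _ _ b⁺) (·-distrib-+ _ _ a⁺) ⟩
      (b⁺ · (a⁺ · x) + b⁺ · R) + (a⁺ · - (b⁺ · x) + a⁺ · R′)   ≈⟨ +-congˡ (+-congʳ (·-distrib-neg a⁺ (b⁺ · x))) ⟩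
      (b⁺ · (a⁺ · x) + b⁺ · R) + (- (a⁺ · (b⁺ · x)) + a⁺ · R′) ≈⟨ interchange _ _ _ _ ⟩
      (b⁺ · (a⁺ · x) - a⁺ · (b⁺ · x)) + (b⁺ · R + a⁺ · R′)     ≈⟨ +-congʳ (x≈y⇒x∙y⁻¹≈ε (·-comm b⁺ a⁺ x)) ⟩
      0# + (b⁺ · R + a⁺ · R′)                                  ≈⟨ identityˡ _ ⟩
      b⁺ · R + a⁺ · R′                                         ≈⟨ sym (+-cong (⟦·ᶠ⟧ b⁺ r xs) (⟦·ᶠ⟧ a⁺ r′ xs)) ⟩
      ⟦ b⁺ ·ᶠ r ⟧ xs + ⟦ a⁺ ·ᶠ r′ ⟧ xs                         ≈⟨ sym (⟦+ᶠ⟧ (b⁺ ·ᶠ r) (a⁺ ·ᶠ r′) xs) ⟩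
      ⟦ b⁺ ·ᶠ r +ᶠ a⁺ ·ᶠ r′ ⟧ xs                               ∎)
      where
      a⁺ = suc a
      b⁺ = suc b
      R = ⟦ r ⟧ xs
      R′ = ⟦ r′ ⟧ xs

    module Satisfaction {q : Level} (positivity : Positivity A q) where

      open Positivity positivity public

      Holds : ∀ {k} → Vec Carrier k → Constraint k → Set q
      Holds xs (f , κ) = IsPositive κ (⟦ f ⟧ xs)

      IsLowerBound IsUpperBound : ∀ {k} → Carrier → Vec Carrier k → Bound k → Set q
      IsLowerBound x xs (bound d r κ) = IsPositive κ (suc d · x + ⟦ r ⟧ xs)
      IsUpperBound x xs (bound d r κ) = IsPositive κ (- (suc d · x) + ⟦ r ⟧ xs)

      record PartitionHolds {k} (x : Carrier) (xs : Vec Carrier k) (P : Partition k) : Set (p ⊔ℓ q) where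
        constructor ⟨_,_,_⟩
        field
          independents-hold : All (Holds xs) (independents P)
          lowers-hold       : All (IsLowerBound x xs) (lowers P)
          uppers-hold       : All (IsUpperBound x xs) (uppers P)

      insert-sound : ∀ {k} {c : Constraint (suc k)} {x xs P} (s : Shape c) →
                     Holds (x ∷ xs) c → PartitionHolds x xs P → PartitionHolds x xs (insert s P)
      insert-sound {x = x} {xs} (independent p cs c κ) h ⟨ is , ls , us ⟩ =
        ⟨ IsPositive-resp κ (trans (+-congʳ (term-zero p x)) (identityˡ _)) h ∷ is , ls , us ⟩
      insert-sound {x = x} (lowerBound q d cs c κ) h ⟨ is , ls , us ⟩ =
        ⟨ is , IsPositive-resp κ (+-congʳ (term-lower q d x)) h ∷ ls , us ⟩
      insert-sound {x = x} (upperBound p d cs c κ) h ⟨ is , ls , us ⟩ =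
        ⟨ is , ls , IsPositive-resp κ (+-congʳ (term-upper p d x)) h ∷ us ⟩

      insert-complete : ∀ {k} {c : Constraint (suc k)} {x xs P} (s : Shape c) →
                        PartitionHolds x xs (insert s P) → Holds (x ∷ xs) c × PartitionHolds x xs P
      insert-complete {x = x} (independent p cs c κ) ⟨ h ∷ is , ls , us ⟩ =
        IsPositive-resp κ (sym (trans (+-congʳ (term-zero p x)) (identityˡ _))) h , ⟨ is , ls , us ⟩
      insert-complete {x = x} (lowerBound q d cs c κ) ⟨ is , h ∷ ls , us ⟩ =
        IsPositive-resp κ (+-congʳ (sym (term-lower q d x))) h , ⟨ is , ls , us ⟩
      insert-complete {x = x} (upperBound p d cs c κ) ⟨ is , ls , h ∷ us ⟩ =
        IsPositive-resp κ (+-congʳ (sym (term-upper p d x))) h , ⟨ is , ls , us ⟩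

      partition-sound : ∀ {k} {x} {xs : Vec Carrier k} cs → All (Holds (x ∷ xs)) cs →
                        PartitionHolds x xs (partition cs)
      partition-sound []       []       = ⟨ [] , [] , [] ⟩
      partition-sound (c ∷ cs) (h ∷ hs) = insert-sound (shape c) h (partition-sound cs hs)

      partition-complete : ∀ {k} {x} {xs : Vec Carrier k} cs → PartitionHolds x xs (partition cs) →
                           All (Holds (x ∷ xs)) cs
      partition-complete []       _  = []
      partition-complete (c ∷ cs) hs with insert-complete (shape c) hs
      ... | h , hs′ = h ∷ partition-complete cs hs′

      combine-sound : ∀ {k} {x} {xs : Vec Carrier k} l u → IsLowerBound x xs l → IsUpperBound x xs u →
                      Holds xs (combine l u)
      combine-sound {x = x} {xs} (bound a r κ) (bound b r′ κ′) lower-holds upper-holds =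
        IsPositive-resp (κ ∨ₛ κ′) (sym (⟦combine⟧ a b r r′ x xs))
          (IsPositive-+ κ κ′ (IsPositive-· κ b lower-holds) (IsPositive-· κ′ a upper-holds))

      eliminate-sound : ∀ {k} {x} {xs : Vec Carrier k} cs → All (Holds (x ∷ xs)) cs → All (Holds xs) (eliminate cs)
      eliminate-sound cs hs with partition-sound cs hs
      ... | ⟨ is , ls , us ⟩ = ++⁺ is (cartesianProductWith⁺ (≡.setoid _) (≡.setoid _) combine (lowers P) (uppers P)
                                         (λ {l} {u} l∈ u∈ → combine-sound l u (All.lookup ls l∈) (All.lookup us u∈)))
        where P = partition cs

module DOAGSolutions {c ℓ : Level} (Γ : DOAG c ℓ) where

  open FourierMotzkin

  open DOAGProperties Γ

  group : AbelianGroup c ℓ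
  group = record { isAbelianGroup = isAbelianGroup }

  positivity : Positivity group ℓ
  positivity = record
    { NonNeg      = 0# ≤_
    ; Pos         = 0# <_
    ; NonNeg-resp = ≤-respʳ-≈
    ; Pos-resp    = <-respʳ-≈
    ; NonNeg-0    = ≤-refl
    ; NonNeg-+    = λ 0≤x 0≤y → ≤-respˡ-≈ (identityˡ 0#) (+-mono-≤ 0≤x 0≤y)
    ; Pos-+       = λ {x} 0<x 0≤y → <-≤-trans 0<x (≤-respˡ-≈ (identityʳ x) (+-monoʳ-≤ x 0≤y))
    ; Pos⇒NonNeg  = <⇒≤
    }

  infix 4 _<[_]_
  _<[_]_ : Carrier → Strictness → Carrier → Set ℓ
  a <[ weak   ] b = a ≤ b
  a <[ strict ] b = a < b

  <⇒<[_] : ∀ κ {a b} → a < b → a <[ κ ] b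
  <⇒<[ weak   ] = <⇒≤
  <⇒<[ strict ] = λ a<b → a<b

  <[_]⇒≤ : ∀ κ {a b} → a <[ κ ] b → a ≤ b
  <[ weak   ]⇒≤ = λ a≤b → a≤b
  <[ strict ]⇒≤ = <⇒≤

  <[∨ₛ]ˡ : ∀ κ κ′ {a b} → a <[ κ ∨ₛ κ′ ] b → a <[ κ ] b
  <[∨ₛ]ˡ weak   κ′ a<b = <[ κ′ ]⇒≤ a<b
  <[∨ₛ]ˡ strict κ′ a<b = a<b

  <[∨ₛ]ʳ : ∀ κ κ′ {a b} → a <[ κ ∨ₛ κ′ ] b → a <[ κ′ ] b
  <[∨ₛ]ʳ weak   κ′     a<b = a<b
  <[∨ₛ]ʳ strict weak   a<b = <⇒≤ a<b
  <[∨ₛ]ʳ strict strict a<b = a<b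

  <[_]-≤-trans : ∀ κ {a b d} → a <[ κ ] b → b ≤ d → a <[ κ ] d
  <[ weak   ]-≤-trans = ≤-trans
  <[ strict ]-≤-trans = <-≤-trans

  x+neg<x : ∀ a → a + proj₁ negative < a
  x+neg<x a = <-respʳ-≈ (identityˡ a) (<-respˡ-≈ (comm _ a) (+-monoˡ-< a (proj₂ negative)))

  x<x-neg : ∀ a → a < a - proj₁ negative
  x<x-neg a = <-respˡ-≈ (x-y+y≈x a (proj₁ negative)) (x+neg<x (a - proj₁ negative))

  midpoint : ∀ {a b} → a < b → ∃ λ m → a < m × m < b
  midpoint {a} {b} a<b with divide 1 (b - a)
  ... | h , 2h≈b-a = a + h , a<a+h , a+h<b
    where
    h+h≈b-a : h + h ≈ b - a
    h+h≈b-a = trans (+-congˡ (sym (identityʳ h))) 2h≈b-a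
    0<h : 0# < h
    0<h h≤0 = x<y⇒0<y-x a<b (≤-respˡ-≈ h+h≈b-a (≤-respʳ-≈ (identityˡ 0#) (+-mono-≤ h≤0 h≤0)))
    step : ∀ d → d < d + h
    step d = <-respʳ-≈ (comm h d) (<-respˡ-≈ (identityˡ d) (+-monoˡ-< d 0<h))
    a<a+h : a < a + h
    a<a+h = step a
    a+h<b : a + h < b
    a+h<b = <-respʳ-≈ (trans (assoc a h h) (trans (+-congˡ h+h≈b-a) (x+[y-x]≈y a b))) (step (a + h))

  _≺_ : Carrier × Strictness → Carrier → Set ℓ
  (v , κ) ≺ x = v <[ κ ] x

  _≻_ : Carrier × Strictness → Carrier → Set ℓ
  (v , κ) ≻ x = x <[ κ ] v

  Compatible : Carrier × Strictness → Carrier × Strictness → Set ℓ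
  Compatible (v , κ) (w , κ′) = v <[ κ ∨ₛ κ′ ] w

  module _ {i} {I : Set i} (f : I → Carrier) where
    open Extrema totalOrder using (argmin; argmax; argmin-sel; argmax-sel;
                                   f[argmin]≤f[⊤]; f[argmin]≤f[xs]; f[⊥]≤f[argmax]; f[xs]≤f[argmax])

    least : ∀ u us → ∃ λ γ → γ ∈ u ∷ us × All (λ u′ → f γ ≤ f u′) (u ∷ us)
    least u us = argmin f u us , member , f[argmin]≤f[⊤] {f = f} u us ∷ f[argmin]≤f[xs] {f = f} u us
      where
      member : argmin f u us ∈ u ∷ us
      member with argmin-sel f u us
      ... | inj₁ γ≡u  = here γ≡u
      ... | inj₂ γ∈us = there γ∈us

    greatest : ∀ l ls → ∃ λ β → β ∈ l ∷ ls × All (λ l′ → f l′ ≤ f β) (l ∷ ls)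
    greatest l ls = argmax f l ls , member , f[⊥]≤f[argmax] {f = f} l ls ∷ f[xs]≤f[argmax] {f = f} l ls
      where
      member : argmax f l ls ∈ l ∷ ls
      member with argmax-sel f l ls
      ... | inj₁ β≡l  = here β≡l
      ... | inj₂ β∈ls = there β∈ls

  -- compatible bounds leave room for a point because Γ is densely ordered without endpoints
  interval : ∀ {i j} {I : Set i} {J : Set j} (lo : I → Carrier × Strictness) (up : J → Carrier × Strictness) ls us →
             (∀ {l u} → l ∈ ls → u ∈ us → Compatible (lo l) (up u)) →
             ∃ λ x → All (λ l → lo l ≺ x) ls × All (λ u → up u ≻ x) us
  interval lo up [] [] _ = 0# , [] , []
  interval lo up [] (u ∷ us) _ with least (proj₁ ∘ up) u us
  ... | γ , _ , γ≤us = proj₁ (up γ) + proj₁ negative , [] ,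
                       All.map (λ {u′} γ≤u′ → <⇒<[ proj₂ (up u′) ] (<-≤-trans (x+neg<x _) γ≤u′)) γ≤us
  interval lo up (l ∷ ls) [] _ with greatest (proj₁ ∘ lo) l ls
  ... | β , _ , ls≤β = proj₁ (lo β) - proj₁ negative ,
                       All.map (λ {l′} l′≤β → <⇒<[ proj₂ (lo l′) ] (≤-<-trans l′≤β (x<x-neg _))) ls≤β , []
  interval lo up (l ∷ ls) (u ∷ us) compatible with greatest (proj₁ ∘ lo) l ls | least (proj₁ ∘ up) u us
  ... | β , β∈ls , ls≤β | γ , γ∈us , γ≤us with proj₁ (up γ) ≤? proj₁ (lo β)
  ...   | yes γ≤β = proj₁ (lo β) ,
    All.tabulate (λ {l′} l′∈ →
      <[ proj₂ (lo l′) ]-≤-trans (<[∨ₛ]ˡ (proj₂ (lo l′)) (proj₂ (up γ)) (compatible l′∈ γ∈us)) γ≤β) ,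
    All.tabulate (λ {u′} u′∈ → <[∨ₛ]ʳ (proj₂ (lo β)) (proj₂ (up u′)) (compatible β∈ls u′∈))
  ...   | no  β<γ with midpoint β<γ
  ...     | m , β<m , m<γ =
    m , All.map (λ {l′} l′≤β → <⇒<[ proj₂ (lo l′) ] (≤-<-trans l′≤β β<m)) ls≤β ,
        All.map (λ {u′} γ≤u′ → <⇒<[ proj₂ (up u′) ] (<-≤-trans m<γ γ≤u′)) γ≤us

  IsPositive-cancel-· : ∀ κ n {v} → Positivity.IsPositive positivity κ (suc n · v) →
                        Positivity.IsPositive positivity κ v
  IsPositive-cancel-· weak   = ·-cancel-nonNeg
  IsPositive-cancel-· strict = ·-cancel-pos

  IsPositive⇒<[_] : ∀ κ {a b} → Positivity.IsPositive positivity κ (b - a) → a <[ κ ] b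
  IsPositive⇒<[ weak   ] = 0≤y-x⇒x≤y
  IsPositive⇒<[ strict ] = 0<y-x⇒x<y

  <[_]⇒IsPositive : ∀ κ {a b} → a <[ κ ] b → Positivity.IsPositive positivity κ (b - a)
  <[ weak   ]⇒IsPositive = x≤y⇒0≤y-x
  <[ strict ]⇒IsPositive = x<y⇒0<y-x

  module Completeness {p p′ : Level} (Par : RawGroup p p′) (π : RawGroup.Carrier Par → Carrier)
                      (π-isHomomorphism : GroupMorphisms.IsGroupHomomorphism Par (AbelianGroup.rawGroup group) π) where

    open Forms Par
    open Semantics Par group π π-isHomomorphism
    open Satisfaction positivity

    -- (suc d) x + r ⋈ 0 says x ⋈ - r / (suc d), and - (suc d) x + r ⋈ 0 says r / (suc d) ⋈ x
    lowerValue upperValue : ∀ {k} → Vec Carrier k → Bound k → Carrier × Strictness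
    lowerValue xs (bound d r κ) = proj₁ (divide d (- ⟦ r ⟧ xs)) , κ
    upperValue xs (bound d r κ) = proj₁ (divide d (⟦ r ⟧ xs)) , κ

    combine-complete : ∀ {k} {xs : Vec Carrier k} l u → Holds xs (combine l u) →
                       Compatible (lowerValue xs l) (upperValue xs u)
    combine-complete {xs = xs} (bound a r κ) (bound b r′ κ′) holds =
      IsPositive⇒<[ κ ∨ₛ κ′ ] (IsPositive-cancel-· (κ ∨ₛ κ′) b
                                 (IsPositive-cancel-· (κ ∨ₛ κ′) a (IsPositive-resp (κ ∨ₛ κ′) ⟦combine⟧≈ holds)))
      where
      β = proj₁ (divide a (- ⟦ r ⟧ xs))
      γ = proj₁ (divide b (⟦ r′ ⟧ xs))
      ⟦combine⟧≈ : ⟦ suc b ·ᶠ r +ᶠ suc a ·ᶠ r′ ⟧ xs ≈ suc a · (suc b · (γ - β))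
      ⟦combine⟧≈ = begin
        ⟦ suc b ·ᶠ r +ᶠ suc a ·ᶠ r′ ⟧ xs                                        ≈⟨ ⟦combine⟧ a b r r′ β xs ⟩
        suc b · (suc a · β + ⟦ r ⟧ xs) + suc a · (- (suc b · β) + ⟦ r′ ⟧ xs)
          ≈⟨ +-congʳ (trans (·-congʳ (suc b) (trans (+-congʳ (proj₂ (divide a _))) (inverseˡ _))) (·-zeroʳ (suc b))) ⟩
        0# + suc a · (- (suc b · β) + ⟦ r′ ⟧ xs)                                 ≈⟨ identityˡ _ ⟩
        suc a · (- (suc b · β) + ⟦ r′ ⟧ xs)
          ≈⟨ ·-congʳ (suc a) (trans (comm _ _) (+-congʳ (sym (proj₂ (divide b _))))) ⟩
        suc a · (suc b · γ - suc b · β)                                          ≈⟨ ·-congʳ (suc a) (sym (·-distrib-- (suc b) γ β)) ⟩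
        suc a · (suc b · (γ - β))                                                ∎
        where open SetoidReasoning setoid

    lower-complete : ∀ {k} {x} {xs : Vec Carrier k} l → lowerValue xs l ≺ x → IsLowerBound x xs l
    lower-complete {x = x} {xs} (bound d r κ) β⋈x =
      IsPositive-resp κ (trans (·-distrib-- (suc d) x β) (+-congˡ (trans (-‿cong (proj₂ (divide d _))) (-‿involutive _))))
        (IsPositive-· κ d (<[ κ ]⇒IsPositive β⋈x))
      where β = proj₁ (divide d (- ⟦ r ⟧ xs))

    upper-complete : ∀ {k} {x} {xs : Vec Carrier k} u → upperValue xs u ≻ x → IsUpperBound x xs u
    upper-complete {x = x} {xs} (bound d r κ) x⋈γ =
      IsPositive-resp κ (trans (·-distrib-- (suc d) γ x) (trans (+-congʳ (proj₂ (divide d _))) (comm _ _)))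
        (IsPositive-· κ d (<[ κ ]⇒IsPositive x⋈γ))
      where γ = proj₁ (divide d (⟦ r ⟧ xs))

    eliminate-complete : ∀ {k} {xs : Vec Carrier k} cs → All (Holds xs) (eliminate cs) →
                         ∃ λ x → All (Holds (x ∷ xs)) cs
    eliminate-complete {xs = xs} cs holds =
      let x , lowers≺x , uppers≻x = interval (lowerValue xs) (upperValue xs) (lowers P) (uppers P) compatible
      in x , partition-complete cs ⟨ ++⁻ˡ (independents P) holds ,
                                     All.map (λ {l} → lower-complete l) lowers≺x ,
                                     All.map (λ {u} → upper-complete u) uppers≻x ⟩
      where
      P = partition cs
      compatible : ∀ {l u} → l ∈ lowers P → u ∈ uppers P → Compatible (lowerValue xs l) (upperValue xs u)
      compatible {l} {u} l∈ u∈ =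
        combine-complete l u (All.lookup (++⁻ʳ (independents P) holds) (∈-cartesianProductWith⁺ combine l∈ u∈))

    module _ {a ℓA q : Level} {A : AbelianGroup a ℓA} {πA : RawGroup.Carrier Par → AbelianGroup.Carrier A}
             (πA-isHomomorphism : GroupMorphisms.IsGroupHomomorphism Par (AbelianGroup.rawGroup A) πA)
             (positivityA : Positivity A q) where

      private
        module SatA = Semantics.Satisfaction Par A πA πA-isHomomorphism positivityA

      solve : (∀ κ c → SatA.IsPositive κ (πA c) → IsPositive κ (π c)) →
              ∀ {k} cs (ws : Vec (AbelianGroup.Carrier A) k) → All (SatA.Holds ws) cs → ∃ λ xs → All (Holds xs) cs
      solve transfer {zero} cs [] holds = [] , All.map (λ { {([] , c) , κ} → transfer κ c }) holds
      solve transfer {suc k} cs (w ∷ ws) holds =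
        let xs , holds′ = solve transfer (eliminate cs) ws (SatA.eliminate-sound cs holds)
            x  , holds″ = eliminate-complete cs holds′
        in x ∷ xs , holds″

module Annotation where

  open FourierMotzkin

  data Atom (n m : ℕ) : Set where
    _≐ᴳ_ : GTerm n → GTerm n → Atom n m
    _≐ᴸ_ : LTerm n m → LTerm n m → Atom n m

  SatAtom : ∀ {gc ge lc le} (S : VLStructure gc ge lc le) {n m} →
            (Fin n → VLStructure.G S) → (Fin m → VLStructure.L S) → Atom n m → Set (ge ⊔ℓ le)
  SatAtom {ge = ge} {le = le} S ρ σ (s ≐ᴳ t) = Lift le (evalG S ρ s ≈G evalG S ρ t)  where open VLStructure S
  SatAtom {ge = ge} {le = le} S ρ σ (s ≐ᴸ t) = Lift ge (evalL S ρ σ s ≈L evalL S ρ σ t) where open VLStructure S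

  -- which argument realises each ∧ / ∨ (true: the left one) and the truth value of each P
  data GAnn {N : ℕ} : GTerm N → Set where
    varₐ : ∀ j → GAnn (var j)
    zerₐ : GAnn zer
    _+ₐ_ : ∀ {s t} → GAnn s → GAnn t → GAnn (s +ₜ t)
    -ₐ_  : ∀ {t} → GAnn t → GAnn (negₜ t)
    minₐ : ∀ {s t} → Bool → GAnn s → GAnn t → GAnn (s ∧ₜ t)
    maxₐ : ∀ {s t} → Bool → GAnn s → GAnn t → GAnn (s ∨ₜ t)

  data LAnn {N M : ℕ} : LTerm N M → Set where
    varₐ : ∀ j → LAnn (var j)
    ⊥ₐ   : LAnn botₜ
    ⊤ₐ   : LAnn topₜ
    _⊓ₐ_ : ∀ {s t} → LAnn s → LAnn t → LAnn (s ⊓ₜ t)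
    _⊔ₐ_ : ∀ {s t} → LAnn s → LAnn t → LAnn (s ⊔ₜ t)
    Pₐ   : ∀ {g} → Bool → GAnn g → LAnn (Pₜ g)

  data AtomAnn {N M : ℕ} : Atom N M → Set where
    _≐ᴳ_ : ∀ {s t} → GAnn s → GAnn t → AtomAnn (s ≐ᴳ t)
    _≐ᴸ_ : ∀ {s t} → LAnn s → LAnn t → AtomAnn (s ≐ᴸ t)

  truth : ∀ {N M} {t : LTerm N M} → (Fin M → Bool) → LAnn t → Bool
  truth bits (varₐ j)   = bits j
  truth bits ⊥ₐ         = false
  truth bits ⊤ₐ         = true
  truth bits (a ⊓ₐ b)   = truth bits a ∧ᵇ truth bits b
  truth bits (a ⊔ₐ b)   = truth bits a ∨ᵇ truth bits b
  truth bits (Pₐ b _)   = b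

  Agrees : ∀ {N M} {at : Atom N M} → (Fin M → Bool) → AtomAnn at → Set
  Agrees bits (_ ≐ᴳ _) = ⊤
  Agrees bits (a ≐ᴸ b) = truth bits a ≡ truth bits b

  AllAgree : ∀ {N M} {as : List (Atom N M)} → (Fin M → Bool) → All AtomAnn as → Set
  AllAgree bits []         = ⊤
  AllAgree bits (a ∷ anns) = Agrees bits a × AllAgree bits anns

  module Linearization {p p′ : Level} (Par : RawGroup p p′) {n k : ℕ} (cG : Fin n → RawGroup.Carrier Par) where

    open Forms Par

    linVar : Fin (n +ℕ k) → LinearForm k
    linVar = (constant ∘ cG) Vector.++ coordinate

    lin : ∀ {t : GTerm (n +ℕ k)} → GAnn t → LinearForm k
    lin (varₐ j)       = linVar j
    lin zerₐ           = constant (RawGroup.ε Par)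
    lin (a +ₐ b)       = lin a +ᶠ lin b
    lin (-ₐ a)         = -ᶠ lin a
    lin (minₐ true  a _) = lin a
    lin (minₐ false _ b) = lin b
    lin (maxₐ true  a _) = lin a
    lin (maxₐ false _ b) = lin b

    constraintsG : ∀ {t : GTerm (n +ℕ k)} → GAnn t → List (Constraint k)
    constraintsG (varₐ j)         = []
    constraintsG zerₐ             = []
    constraintsG (a +ₐ b)         = constraintsG a ++ constraintsG b
    constraintsG (-ₐ a)           = constraintsG a
    constraintsG (minₐ true  a b) = (lin b -ᶠ lin a , weak)   ∷ constraintsG a ++ constraintsG b
    constraintsG (minₐ false a b) = (lin a -ᶠ lin b , strict) ∷ constraintsG a ++ constraintsG b
    constraintsG (maxₐ true  a b) = (lin a -ᶠ lin b , weak)   ∷ constraintsG a ++ constraintsG b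
    constraintsG (maxₐ false a b) = (lin b -ᶠ lin a , strict) ∷ constraintsG a ++ constraintsG b

    constraintsL : ∀ {M} {t : LTerm (n +ℕ k) M} → LAnn t → List (Constraint k)
    constraintsL (varₐ j)     = []
    constraintsL ⊥ₐ           = []
    constraintsL ⊤ₐ           = []
    constraintsL (a ⊓ₐ b)     = constraintsL a ++ constraintsL b
    constraintsL (a ⊔ₐ b)     = constraintsL a ++ constraintsL b
    constraintsL (Pₐ true  g) = (lin g , weak)      ∷ constraintsG g
    constraintsL (Pₐ false g) = (-ᶠ lin g , strict) ∷ constraintsG g

    constraintsA : ∀ {M} {at : Atom (n +ℕ k) M} → AtomAnn at → List (Constraint k)
    constraintsA (a ≐ᴳ b) = (lin a -ᶠ lin b , weak) ∷ (lin b -ᶠ lin a , weak) ∷ constraintsG a ++ constraintsG b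
    constraintsA (a ≐ᴸ b) = constraintsL a ++ constraintsL b

    constraints : ∀ {M} {as : List (Atom (n +ℕ k) M)} → All AtomAnn as → List (Constraint k)
    constraints []         = []
    constraints (a ∷ anns) = constraintsA a ++ constraints anns

module ConjunctiveForm where

  open Annotation using (Atom; _≐ᴳ_; _≐ᴸ_; SatAtom)

  renameG : ∀ {a b} → (Fin a → Fin b) → GTerm a → GTerm b
  renameG r (var j)  = var (r j)
  renameG r zer      = zer
  renameG r (s +ₜ t) = renameG r s +ₜ renameG r t
  renameG r (negₜ t) = negₜ (renameG r t)
  renameG r (s ∧ₜ t) = renameG r s ∧ₜ renameG r t
  renameG r (s ∨ₜ t) = renameG r s ∨ₜ renameG r t

  renameL : ∀ {a b a′ b′} → (Fin a → Fin b) → (Fin a′ → Fin b′) → LTerm a a′ → LTerm b b′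
  renameL r r′ (var j)  = var (r′ j)
  renameL r r′ botₜ     = botₜ
  renameL r r′ topₜ     = topₜ
  renameL r r′ (s ⊓ₜ t) = renameL r r′ s ⊓ₜ renameL r r′ t
  renameL r r′ (s ⊔ₜ t) = renameL r r′ s ⊔ₜ renameL r r′ t
  renameL r r′ (Pₜ g)   = Pₜ (renameG r g)

  renameA : ∀ {a b a′ b′} → (Fin a → Fin b) → (Fin a′ → Fin b′) → Atom a a′ → Atom b b′
  renameA r r′ (s ≐ᴳ t) = renameG r s ≐ᴳ renameG r t
  renameA r r′ (s ≐ᴸ t) = renameL r r′ s ≐ᴸ renameL r r′ t

  module _ {gc ge lc le : Level} (S : VLStructure gc ge lc le) where

    open VLStructure S

    evalG-rename : ∀ {a b} {ρ : Fin b → G} {ρ′ : Fin a → G} (r : Fin a → Fin b) →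
                   (∀ j → ρ (r j) ≡ ρ′ j) → ∀ t → evalG S ρ (renameG r t) ≡ evalG S ρ′ t
    evalG-rename r ρ∘r≗ρ′ (var j)  = ρ∘r≗ρ′ j
    evalG-rename r ρ∘r≗ρ′ zer      = ≡.refl
    evalG-rename r ρ∘r≗ρ′ (s +ₜ t) = ≡.cong₂ _+_ (evalG-rename r ρ∘r≗ρ′ s) (evalG-rename r ρ∘r≗ρ′ t)
    evalG-rename r ρ∘r≗ρ′ (negₜ t) = ≡.cong -_ (evalG-rename r ρ∘r≗ρ′ t)
    evalG-rename r ρ∘r≗ρ′ (s ∧ₜ t) = ≡.cong₂ _∧_ (evalG-rename r ρ∘r≗ρ′ s) (evalG-rename r ρ∘r≗ρ′ t)
    evalG-rename r ρ∘r≗ρ′ (s ∨ₜ t) = ≡.cong₂ _∨_ (evalG-rename r ρ∘r≗ρ′ s) (evalG-rename r ρ∘r≗ρ′ t)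

    evalL-rename : ∀ {a b a′ b′} {ρ : Fin b → G} {ρ′ : Fin a → G} {σ : Fin b′ → L} {σ′ : Fin a′ → L}
                   (r : Fin a → Fin b) (r′ : Fin a′ → Fin b′) → (∀ j → ρ (r j) ≡ ρ′ j) → (∀ j → σ (r′ j) ≡ σ′ j) →
                   ∀ t → evalL S ρ σ (renameL r r′ t) ≡ evalL S ρ′ σ′ t
    evalL-rename r r′ ρ≗ σ≗ (var j)  = σ≗ j
    evalL-rename r r′ ρ≗ σ≗ botₜ     = ≡.refl
    evalL-rename r r′ ρ≗ σ≗ topₜ     = ≡.refl
    evalL-rename r r′ ρ≗ σ≗ (s ⊓ₜ t) = ≡.cong₂ _⊓_ (evalL-rename r r′ ρ≗ σ≗ s) (evalL-rename r r′ ρ≗ σ≗ t)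
    evalL-rename r r′ ρ≗ σ≗ (s ⊔ₜ t) = ≡.cong₂ _⊔L_ (evalL-rename r r′ ρ≗ σ≗ s) (evalL-rename r r′ ρ≗ σ≗ t)
    evalL-rename r r′ ρ≗ σ≗ (Pₜ g)   = ≡.cong P (evalG-rename r ρ≗ g)

    SatAtom-rename : ∀ {a b a′ b′} {ρ : Fin b → G} {ρ′ : Fin a → G} {σ : Fin b′ → L} {σ′ : Fin a′ → L}
                     (r : Fin a → Fin b) (r′ : Fin a′ → Fin b′) → (∀ j → ρ (r j) ≡ ρ′ j) → (∀ j → σ (r′ j) ≡ σ′ j) →
                     ∀ at → SatAtom S ρ σ (renameA r r′ at) ⇔ SatAtom S ρ′ σ′ at
    SatAtom-rename r r′ ρ≗ σ≗ (s ≐ᴳ t) =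
      mk⇔ (λ (lift s≈t) → lift (≡.subst₂ _≈G_ (evalG-rename r ρ≗ s) (evalG-rename r ρ≗ t) s≈t))
          (λ (lift s≈t) → lift (≡.subst₂ _≈G_ (≡.sym (evalG-rename r ρ≗ s)) (≡.sym (evalG-rename r ρ≗ t)) s≈t))
    SatAtom-rename r r′ ρ≗ σ≗ (s ≐ᴸ t) =
      mk⇔ (λ (lift s≈t) → lift (≡.subst₂ _≈L_ (evalL-rename r r′ ρ≗ σ≗ s) (evalL-rename r r′ ρ≗ σ≗ t) s≈t))
          (λ (lift s≈t) → lift (≡.subst₂ _≈L_ (≡.sym (evalL-rename r r′ ρ≗ σ≗ s)) (≡.sym (evalL-rename r r′ ρ≗ σ≗ t)) s≈t))

    All-SatAtom-rename : ∀ {a b a′ b′} {ρ : Fin b → G} {ρ′ : Fin a → G} {σ : Fin b′ → L} {σ′ : Fin a′ → L}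
                         (r : Fin a → Fin b) (r′ : Fin a′ → Fin b′) →
                         (∀ j → ρ (r j) ≡ ρ′ j) → (∀ j → σ (r′ j) ≡ σ′ j) →
                         ∀ {atoms} → All (SatAtom S ρ σ) (map (renameA r r′) atoms) ⇔ All (SatAtom S ρ′ σ′) atoms
    All-SatAtom-rename r r′ ρ≗ σ≗ =
      mk⇔ (All.map (λ {at} → Equivalence.to (SatAtom-rename r r′ ρ≗ σ≗ at)) ∘ map⁻)
          (map⁺ ∘ All.map (λ {at} → Equivalence.from (SatAtom-rename r r′ ρ≗ σ≗ at)))

  -- the context of a conjunction lists the free variables first and the existential witnesses after them
  bindFirst : ∀ {n k} → Fin (suc n +ℕ k) → Fin (n +ℕ suc k)
  bindFirst {n} {k} = (n ↑ʳ zero) Vector.∷ Vector._++_ {m = n} (_↑ˡ suc k) ((n ↑ʳ_) ∘ suc)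

  joinˡ : ∀ {n} k₁ k₂ → Fin (n +ℕ k₁) → Fin (n +ℕ (k₁ +ℕ k₂))
  joinˡ {n} k₁ k₂ = Vector._++_ {m = n} (_↑ˡ (k₁ +ℕ k₂)) ((n ↑ʳ_) ∘ (_↑ˡ k₂))

  joinʳ : ∀ {n} k₁ k₂ → Fin (n +ℕ k₂) → Fin (n +ℕ (k₁ +ℕ k₂))
  joinʳ {n} k₁ k₂ = Vector._++_ {m = n} (_↑ˡ (k₁ +ℕ k₂)) ((n ↑ʳ_) ∘ (k₁ ↑ʳ_))

  module _ {a : Level} {A : Set a} where

    ↑ˡ-++ : ∀ {n} (ρ : Fin n → A) (η : Fin 0 → A) j → (ρ Vector.++ η) (j ↑ˡ 0) ≡ ρ j
    ↑ˡ-++ ρ η = lookup-++ˡ ρ η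

    joinˡ-++ : ∀ {n k₁ k₂} (ρ : Fin n → A) (η : Fin (k₁ +ℕ k₂) → A) →
               ∀ j → (ρ Vector.++ η) (joinˡ k₁ k₂ j) ≡ (ρ Vector.++ (η ∘ (_↑ˡ k₂))) j
    joinˡ-++ {n} {k₁} {k₂} ρ η =
      Pointwise.++⁺ (λ u v → (ρ Vector.++ η) u ≡ v) {m = n} (lookup-++ˡ ρ η) (λ c → lookup-++ʳ ρ η (c ↑ˡ k₂))

    joinʳ-++ : ∀ {n k₁ k₂} (ρ : Fin n → A) (η : Fin (k₁ +ℕ k₂) → A) →
               ∀ j → (ρ Vector.++ η) (joinʳ k₁ k₂ j) ≡ (ρ Vector.++ (η ∘ (k₁ ↑ʳ_))) j
    joinʳ-++ {n} {k₁} {k₂} ρ η =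
      Pointwise.++⁺ (λ u v → (ρ Vector.++ η) u ≡ v) {m = n} (lookup-++ˡ ρ η) (λ c → lookup-++ʳ ρ η (k₁ ↑ʳ c))

    joinˡ-++-++ : ∀ {n k₁ k₂} (ρ : Fin n → A) (η₁ : Fin k₁ → A) (η₂ : Fin k₂ → A) →
                  ∀ j → (ρ Vector.++ (η₁ Vector.++ η₂)) (joinˡ k₁ k₂ j) ≡ (ρ Vector.++ η₁) j
    joinˡ-++-++ ρ η₁ η₂ j = ≡.trans (joinˡ-++ ρ (η₁ Vector.++ η₂) j) (++-cong ρ ρ (λ _ → ≡.refl) (lookup-++ˡ η₁ η₂) j)

    joinʳ-++-++ : ∀ {n k₁ k₂} (ρ : Fin n → A) (η₁ : Fin k₁ → A) (η₂ : Fin k₂ → A) →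
                  ∀ j → (ρ Vector.++ (η₁ Vector.++ η₂)) (joinʳ k₁ k₂ j) ≡ (ρ Vector.++ η₂) j
    joinʳ-++-++ ρ η₁ η₂ j = ≡.trans (joinʳ-++ ρ (η₁ Vector.++ η₂) j) (++-cong ρ ρ (λ _ → ≡.refl) (lookup-++ʳ η₁ η₂) j)

    bindFirst-++ : ∀ {n k} (ρ : Fin n → A) (η : Fin (suc k) → A) →
                   ∀ j → (ρ Vector.++ η) (bindFirst j) ≡ (extend (η zero) ρ Vector.++ (η ∘ suc)) j
    bindFirst-++ {n} ρ η zero = lookup-++ʳ ρ η zero
    bindFirst-++ {n} ρ η (suc j) with splitAt n j
    ... | inj₁ b = lookup-++ˡ ρ η b
    ... | inj₂ c = lookup-++ʳ ρ η (suc c)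

  module Extraction {vgc vge vlc vle wgc wge wlc wle : Level}
                    (V : VLStructure vgc vge vlc vle) (W : VLStructure wgc wge wlc wle) where

    private
      module V = VLStructure V
      module W = VLStructure W

    -- the disjunct of φ selected by a proof of W ⊨ φ, as a conjunction of atoms together with its witnesses in W
    record Conjunction {n m} (φ : PEFormula n m) (ρ : Fin n → W.G) (σ : Fin m → W.L)
           : Set (vgc ⊔ℓ vge ⊔ℓ vlc ⊔ℓ vle ⊔ℓ wgc ⊔ℓ wge ⊔ℓ wlc ⊔ℓ wle) where
      field
        {k k′}  : ℕ
        atoms   : List (Atom (n +ℕ k) (m +ℕ k′))
        η       : Fin k → W.G
        θ       : Fin k′ → W.L
        holds   : All (SatAtom W (ρ Vector.++ η) (σ Vector.++ θ)) atoms
        entails : ∀ ρ′ σ′ η′ θ′ → All (SatAtom V (ρ′ Vector.++ η′) (σ′ Vector.++ θ′)) atoms → Sat V φ ρ′ σ′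
    open Conjunction

    atomic : ∀ {n m} {φ : PEFormula n m} {ρ σ} (at : Atom n m) → SatAtom W ρ σ at →
             (∀ {ρ′ σ′} → SatAtom V ρ′ σ′ at → Sat V φ ρ′ σ′) → Conjunction φ ρ σ
    atomic {ρ = ρ} {σ} at sat entailed = record
      { k       = 0
      ; k′      = 0
      ; atoms   = renameA (_↑ˡ 0) (_↑ˡ 0) at ∷ []
      ; η       = λ ()
      ; θ       = λ ()
      ; holds   = Equivalence.from (SatAtom-rename W _ _ (↑ˡ-++ ρ _) (↑ˡ-++ σ _) at) sat ∷ []
      ; entails = λ { ρ′ σ′ η′ θ′ (h ∷ []) →
                      entailed (Equivalence.to (SatAtom-rename V _ _ (↑ˡ-++ ρ′ η′) (↑ˡ-++ σ′ θ′) at) h) }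
      }

    conjunction : ∀ {n m} (φ : PEFormula n m) ρ σ → Sat W φ ρ σ → Conjunction φ ρ σ
    conjunction trueF      ρ σ _            = record
      { k = 0 ; k′ = 0 ; atoms = [] ; η = λ () ; θ = λ () ; holds = [] ; entails = λ _ _ _ _ _ → lift tt }
    conjunction (eqG s t)  ρ σ (lift s≈t)   = atomic (s ≐ᴳ t) (lift s≈t) (λ (lift s≈t) → lift s≈t)
    conjunction (eqL s t)  ρ σ (lift s≈t)   = atomic (s ≐ᴸ t) (lift s≈t) (λ (lift s≈t) → lift s≈t)
    conjunction (orF φ ψ)  ρ σ (inj₁ sat)   = let c = conjunction φ ρ σ sat in
      record { Conjunction c ; entails = λ ρ′ σ′ η′ θ′ h → inj₁ (entails c ρ′ σ′ η′ θ′ h) }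
    conjunction (orF φ ψ)  ρ σ (inj₂ sat)   = let c = conjunction ψ ρ σ sat in
      record { Conjunction c ; entails = λ ρ′ σ′ η′ θ′ h → inj₂ (entails c ρ′ σ′ η′ θ′ h) }
    conjunction (andF φ ψ) ρ σ (sφ , sψ)    = record
      { atoms   = atoms₁ ++ map (renameA (joinʳ k₁ k₂) (joinʳ l₁ l₂)) (atoms c₂)
      ; η       = η c₁ Vector.++ η c₂
      ; θ       = θ c₁ Vector.++ θ c₂
      ; holds   = ++⁺ (Equivalence.from (All-SatAtom-rename W _ _ (joinˡ-++-++ ρ (η c₁) (η c₂))
                                                                (joinˡ-++-++ σ (θ c₁) (θ c₂))) (holds c₁))
                      (Equivalence.from (All-SatAtom-rename W _ _ (joinʳ-++-++ ρ (η c₁) (η c₂))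
                                                                (joinʳ-++-++ σ (θ c₁) (θ c₂))) (holds c₂))
      ; entails = λ ρ′ σ′ η′ θ′ h →
          entails c₁ ρ′ σ′ _ _ (Equivalence.to (All-SatAtom-rename V _ _ (joinˡ-++ {k₁ = k₁} ρ′ η′)
                                                                       (joinˡ-++ {k₁ = l₁} σ′ θ′)) (++⁻ˡ atoms₁ h)) ,
          entails c₂ ρ′ σ′ _ _ (Equivalence.to (All-SatAtom-rename V _ _ (joinʳ-++ {k₁ = k₁} ρ′ η′)
                                                                       (joinʳ-++ {k₁ = l₁} σ′ θ′)) (++⁻ʳ atoms₁ h))
      }
      where
      c₁ : Conjunction φ ρ σ
      c₁ = conjunction φ ρ σ sφ
      c₂ : Conjunction ψ ρ σ
      c₂ = conjunction ψ ρ σ sψ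
      k₁ = k c₁ ; k₂ = k c₂ ; l₁ = k′ c₁ ; l₂ = k′ c₂
      atoms₁ = map (renameA (joinˡ k₁ k₂) (joinˡ l₁ l₂)) (atoms c₁)
    conjunction (existsG φ) ρ σ (x , sat)  = let c = conjunction φ (extend x ρ) σ sat in record
      { atoms   = map (renameA bindFirst id) (atoms c)
      ; η       = x Vector.∷ η c
      ; θ       = θ c
      ; holds   = Equivalence.from (All-SatAtom-rename W _ _ (bindFirst-++ ρ (x Vector.∷ η c)) (λ _ → ≡.refl)) (holds c)
      ; entails = λ ρ′ σ′ η′ θ′ h →
          η′ zero , entails c _ σ′ _ θ′ (Equivalence.to (All-SatAtom-rename V _ _ (bindFirst-++ ρ′ η′) (λ _ → ≡.refl)) h)
      }
    conjunction (existsL φ) ρ σ (y , sat)  = let c = conjunction φ ρ (extend y σ) sat in record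
      { atoms   = map (renameA id bindFirst) (atoms c)
      ; η       = η c
      ; θ       = y Vector.∷ θ c
      ; holds   = Equivalence.from (All-SatAtom-rename W _ _ (λ _ → ≡.refl) (bindFirst-++ σ (y Vector.∷ θ c))) (holds c)
      ; entails = λ ρ′ σ′ η′ θ′ h →
          θ′ zero , entails c ρ′ _ η′ _ (Equivalence.to (All-SatAtom-rename V _ _ (λ _ → ≡.refl) (bindFirst-++ σ′ θ′)) h)
      }

module PointFilter {c ℓ x : Level} {Γ : DOAG c ℓ} {X : Set x}
                   {gc ge lc le : Level} {W : VLStructure gc ge lc le} (isValued : IsValuedLGroup W)
                   (e : Embedding (Stan Γ X) W) (i : X) where

  open ValuedLGroup using (module Notation; module Properties)

  open Notation W
  open Properties isValued
  open Lₒ using (≤-refl; ≤-trans; x∧y≤x; x∧y≤y; x≤x∨y; y≤x∨y; ∧-greatest; ∨-least; ∧-monotonic; ∨-monotonic;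
                 sequent-mono; sequent-∧ʳ; sequent-∨ˡ; sequent-cut)
  open Embedding e using (fL; fL-inj; f-⊓; f-⊔)

  -- the meet of the values decided true so far, and the join of those decided false
  record Frame : Set lc where
    constructor ⟨_∣_⟩
    field
      assumed refuted : L
  open Frame

  -- a ⊢[ s ] b: a entails b modulo the filter generated by s and by the subsets containing i,
  -- and the ideal generated by s and by the subsets avoiding i
  infix 3 _⊢[_]_
  record _⊢[_]_ (a : L) (s : Frame) (b : L) : Set (x ⊔ℓ lsuc ℓ ⊔ℓ le) where
    constructor entails
    field
      {A B}   : Pred X ℓ
      i∈A     : A i
      i∉B     : ¬ B i
      sequent : (fL A ⊓ assumed s) ⊓ a ⊑ b ⊔ (fL B ⊔ refuted s)

  private
    full empty : Pred X ℓ
    full  _ = Lift ℓ ⊤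
    empty _ = Lift ℓ ⊥

    i∉empty : ¬ empty i
    i∉empty ()

    restrict : ∀ {A A′ B B′ m k a b} → fL A′ ⊑ fL A → fL B ⊑ fL B′ →
               (fL A ⊓ m) ⊓ a ⊑ b ⊔ (fL B ⊔ k) → (fL A′ ⊓ m) ⊓ a ⊑ b ⊔ (fL B′ ⊔ k)
    restrict A′⊑A B⊑B′ = sequent-mono (∧-monotonic A′⊑A ≤-refl) ≤-refl ≤-refl (∨-monotonic B⊑B′ ≤-refl)

    fL-∩ˡ : ∀ A A′ → fL (A ∩ A′) ⊑ fL A
    fL-∩ˡ A A′ = Lₒ.≤-respˡ-≈ (Lₑ.sym (f-⊓ A A′)) (x∧y≤x _ _)
    fL-∩ʳ : ∀ A A′ → fL (A ∩ A′) ⊑ fL A′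
    fL-∩ʳ A A′ = Lₒ.≤-respˡ-≈ (Lₑ.sym (f-⊓ A A′)) (x∧y≤y _ _)
    fL-∪ˡ : ∀ B B′ → fL B ⊑ fL (B ∪ B′)
    fL-∪ˡ B B′ = Lₒ.≤-respʳ-≈ (Lₑ.sym (f-⊔ B B′)) (x≤x∨y _ _)
    fL-∪ʳ : ∀ B B′ → fL B′ ⊑ fL (B ∪ B′)
    fL-∪ʳ B B′ = Lₒ.≤-respʳ-≈ (Lₑ.sym (f-⊔ B B′)) (y≤x∨y _ _)

    combine : ∀ {s a b a′ b′ a″ b″} →
              (∀ {h j} → h ⊓ a ⊑ b ⊔ j → h ⊓ a′ ⊑ b′ ⊔ j → h ⊓ a″ ⊑ b″ ⊔ j) →
              a ⊢[ s ] b → a′ ⊢[ s ] b′ → a″ ⊢[ s ] b″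
    combine rule (entails {A} {B} i∈A i∉B p) (entails {A′} {B′} i∈A′ i∉B′ q) =
      entails (i∈A , i∈A′) [ i∉B , i∉B′ ]
              (rule (restrict (fL-∩ˡ A A′) (fL-∪ˡ B B′) p) (restrict (fL-∩ʳ A A′) (fL-∪ʳ B B′) q))

  axiom : ∀ {s a b} → a ⊑ b → a ⊢[ s ] b
  axiom a⊑b = entails {A = full} {empty} (lift tt) i∉empty (≤-trans (x∧y≤y _ _) (≤-trans a⊑b (x≤x∨y _ _)))

  weaken : ∀ {s a a′ b b′} → a′ ⊑ a → b ⊑ b′ → a ⊢[ s ] b → a′ ⊢[ s ] b′
  weaken a′⊑a b⊑b′ (entails i∈A i∉B p) = entails i∈A i∉B (sequent-mono ≤-refl a′⊑a b⊑b′ ≤-refl p)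

  ⊢-⊓ʳ : ∀ {s a b b′} → a ⊢[ s ] b → a ⊢[ s ] b′ → a ⊢[ s ] b ⊓ b′
  ⊢-⊓ʳ = combine sequent-∧ʳ

  ⊢-⊔ˡ : ∀ {s a a′ b} → a ⊢[ s ] b → a′ ⊢[ s ] b → a ⊔ a′ ⊢[ s ] b
  ⊢-⊔ˡ = combine sequent-∨ˡ

  cut : ∀ {s a b d} → a ⊢[ s ] b ⊔ d → a ⊓ d ⊢[ s ] b → a ⊢[ s ] b
  cut = combine sequent-cut

  assumption : ∀ {s} → ⊤L ⊢[ s ] assumed s
  assumption = entails {A = full} {empty} (lift tt) i∉empty
                       (≤-trans (x∧y≤x _ _) (≤-trans (x∧y≤y _ _) (x≤x∨y _ _)))

  refutation : ∀ {s} → refuted s ⊢[ s ] ⊥L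
  refutation = entails {A = full} {empty} (lift tt) i∉empty
                       (≤-trans (x∧y≤y _ _) (≤-trans (y≤x∨y _ _) (y≤x∨y _ _)))

  infix 4 _≼_
  record _≼_ (s s′ : Frame) : Set le where
    constructor _,_
    field
      assumed-⊒ : assumed s′ ⊑ assumed s
      refuted-⊑ : refuted s ⊑ refuted s′

  ≼-refl : ∀ {s} → s ≼ s
  ≼-refl = ≤-refl , ≤-refl

  ≼-trans : ∀ {s s′ s″} → s ≼ s′ → s′ ≼ s″ → s ≼ s″
  ≼-trans (m′⊑m , k⊑k′) (m″⊑m′ , k′⊑k″) = ≤-trans m″⊑m′ m′⊑m , ≤-trans k⊑k′ k′⊑k″

  ⊢-mono : ∀ {s s′ a b} → s ≼ s′ → a ⊢[ s ] b → a ⊢[ s′ ] b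
  ⊢-mono (m′⊑m , k⊑k′) (entails i∈A i∉B p) =
    entails i∈A i∉B (sequent-mono (∧-monotonic ≤-refl m′⊑m) ≤-refl ≤-refl (∨-monotonic ≤-refl k⊑k′) p)

  Consistent : Frame → Set (x ⊔ℓ lsuc ℓ ⊔ℓ le)
  Consistent s = ¬ (⊤L ⊢[ s ] ⊥L)

  ⊢-contradiction : ∀ {s a} → ⊤L ⊢[ s ] a → a ⊢[ s ] ⊥L → ⊤L ⊢[ s ] ⊥L
  ⊢-contradiction ⊤⊢a a⊢⊥ = cut (weaken ≤-refl (y≤x∨y _ _) ⊤⊢a) (weaken (x∧y≤y _ _) ≤-refl a⊢⊥)

  initial-consistent : Consistent ⟨ ⊤L ∣ ⊥L ⟩
  initial-consistent (entails {A} {B} i∈A i∉B p) = i∉B (proj₂ (Equivalence.to (fL-inj fL[A]≈fL[A∩B] i) i∈A))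
    where
    fL[A]⊑fL[B] : fL A ⊑ fL B
    fL[A]⊑fL[B] = ≤-trans (∧-greatest (∧-greatest ≤-refl (x⊑⊤ _)) (x⊑⊤ _))
                          (≤-trans p (∨-least (⊥⊑x _) (∨-least ≤-refl (⊥⊑x _))))
    fL[A]≈fL[A∩B] : fL A ≈L fL (A ∩ B)
    fL[A]≈fL[A∩B] = Lₑ.trans fL[A]⊑fL[B] (Lₑ.sym (f-⊓ A B))

  discharge : ∀ {m k a b d} → b ⊢[ ⟨ m ⊓ a ∣ k ⟩ ] d → b ⊓ a ⊢[ ⟨ m ∣ k ⟩ ] d
  discharge {m} {k} {a} {b} (entails {A} i∈A i∉B p) = entails i∈A i∉B (≤-trans regroup p)
    where
    regroup : (fL A ⊓ m) ⊓ (b ⊓ a) ⊑ (fL A ⊓ (m ⊓ a)) ⊓ b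
    regroup = ∧-greatest (∧-greatest (≤-trans (x∧y≤x _ _) (x∧y≤x _ _))
                                     (∧-greatest (≤-trans (x∧y≤x _ _) (x∧y≤y _ _)) (≤-trans (x∧y≤y _ _) (x∧y≤y _ _))))
                         (≤-trans (x∧y≤y _ _) (x∧y≤x _ _))

  refute : ∀ {m k a b d} → b ⊢[ ⟨ m ∣ k ⊔ a ⟩ ] d → b ⊢[ ⟨ m ∣ k ⟩ ] d ⊔ a
  refute {m} {k} {a} {b} {d} (entails {B = B} i∈A i∉B p) = entails i∈A i∉B (≤-trans p regroup)
    where
    regroup : d ⊔ (fL B ⊔ (k ⊔ a)) ⊑ (d ⊔ a) ⊔ (fL B ⊔ k)
    regroup = ∨-least (≤-trans (x≤x∨y d a) (x≤x∨y _ _))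
                      (∨-least (≤-trans (x≤x∨y _ k) (y≤x∨y _ _))
                               (∨-least (≤-trans (y≤x∨y (fL B) k) (y≤x∨y _ _)) (≤-trans (y≤x∨y d a) (x≤x∨y _ _))))

  Verdict : Frame → Bool → L → Set (x ⊔ℓ lsuc ℓ ⊔ℓ le)
  Verdict s true  a = ⊤L ⊢[ s ] a
  Verdict s false a = a ⊢[ s ] ⊥L

  Decided : Frame → L → Set (x ⊔ℓ lsuc ℓ ⊔ℓ le)
  Decided s a = Σ Bool λ b → Verdict s b a

  verdict-mono : ∀ {s s′} → s ≼ s′ → ∀ b {a} → Verdict s b a → Verdict s′ b a
  verdict-mono s≼s′ true  = ⊢-mono s≼s′
  verdict-mono s≼s′ false = ⊢-mono s≼s′

  record Extension (s : Frame) (as : List L) : Set (lc ⊔ℓ x ⊔ℓ lsuc ℓ ⊔ℓ le) where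
    constructor extension
    field
      frame      : Frame
      extends    : s ≼ frame
      consistent : Consistent frame
      decisions  : All (Decided frame) as

  -- if assuming a makes the frame inconsistent then a ⊢ ⊥ already, so refuting a keeps it consistent
  decide : ExcludedMiddle (x ⊔ℓ lsuc ℓ ⊔ℓ le) → ∀ {s} → Consistent s → (a : L) → Extension s (a ∷ [])
  decide em {⟨ m ∣ k ⟩} consistent a with em {⊤L ⊢[ ⟨ m ⊓ a ∣ k ⟩ ] ⊥L}
  ... | no ⊬⊥ = extension ⟨ m ⊓ a ∣ k ⟩ (x∧y≤x m a , ≤-refl) ⊬⊥ ((true , weaken ≤-refl (x∧y≤y m a) assumption) ∷ [])
  ... | yes ⊢⊥ =
    extension ⟨ m ∣ k ⊔ a ⟩ (≤-refl , x≤x∨y k a) consistent′ ((false , weaken (y≤x∨y k a) ≤-refl refutation) ∷ [])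
    where
    consistent′ : Consistent ⟨ m ∣ k ⊔ a ⟩
    consistent′ ⊤⊢⊥ = consistent (⊢-contradiction (weaken ≤-refl (∨-least (⊥⊑x a) ≤-refl) (refute ⊤⊢⊥))
                                                   (weaken (∧-greatest (x⊑⊤ a) ≤-refl) ≤-refl (discharge ⊢⊥)))

  decideAll : ExcludedMiddle (x ⊔ℓ lsuc ℓ ⊔ℓ le) → ∀ {s} → Consistent s → (as : List L) → Extension s as
  decideAll em consistent []       = extension _ ≼-refl consistent []
  decideAll em consistent (a ∷ as) with decide em consistent a
  ... | extension s₁ s≼s₁ consistent₁ ((b , verdict) ∷ []) with decideAll em consistent₁ as
  ...   | extension s₂ s₁≼s₂ consistent₂ decisions =
    extension s₂ (≼-trans s≼s₁ s₁≼s₂) consistent₂ ((b , verdict-mono s₁≼s₂ b verdict) ∷ decisions)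

  ∈⇒⊤⊢ : ∀ {s} {A : Pred X ℓ} → A i → ⊤L ⊢[ s ] fL A
  ∈⇒⊤⊢ {A = A} i∈A = entails {A = A} {empty} i∈A i∉empty (≤-trans (x∧y≤x _ _) (≤-trans (x∧y≤x _ _) (x≤x∨y _ _)))

  ∉⇒⊢⊥ : ∀ {s} {B : Pred X ℓ} → ¬ B i → fL B ⊢[ s ] ⊥L
  ∉⇒⊢⊥ {B = B} i∉B = entails {A = full} {B} (lift tt) i∉B (≤-trans (x∧y≤y _ _) (≤-trans (x≤x∨y _ _) (y≤x∨y _ _)))

  ⊤⊢⇒∈ : ExcludedMiddle ℓ → ∀ {s} {A : Pred X ℓ} → Consistent s → ⊤L ⊢[ s ] fL A → A i
  ⊤⊢⇒∈ em {A = A} consistent ⊤⊢A with em {A i}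
  ... | yes i∈A = i∈A
  ... | no  i∉A = ⊥-elim (consistent (⊢-contradiction ⊤⊢A (∉⇒⊢⊥ i∉A)))

  ⊢⊥⇒∉ : ∀ {s} {B : Pred X ℓ} → Consistent s → fL B ⊢[ s ] ⊥L → ¬ B i
  ⊢⊥⇒∉ consistent B⊢⊥ i∈B = consistent (⊢-contradiction (∈⇒⊤⊢ i∈B) B⊢⊥)

  membership-verdict : ∀ {s} {A : Pred X ℓ} (A? : Dec (A i)) → Verdict s (isYes A?) (fL A)
  membership-verdict (yes i∈A) = ∈⇒⊤⊢ i∈A
  membership-verdict (no  i∉A) = ∉⇒⊢⊥ i∉A

module PointSemantics {c ℓ x : Level} (Γ : DOAG c ℓ) (X : Set x) where

  open FourierMotzkin
  open ValuedLGroup using (groupSort)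
  open Annotation

  open DOAGProperties Γ
  open DOAGSolutions Γ using (group; positivity; _<[_]_; IsPositive⇒<[_])

  V : VLStructure _ _ _ _
  V = Stan Γ X

  SatAtomAt : ∀ {n m} → X → (Fin n → X → Carrier) → (Fin m → Pred X ℓ) → Atom n m → Set ℓ
  SatAtomAt i ρ σ (s ≐ᴳ t) = evalG V ρ s i ≈ evalG V ρ t i
  SatAtomAt i ρ σ (s ≐ᴸ t) = evalL V ρ σ s i ⇔ evalL V ρ σ t i

  SatAtom-pointwise : ∀ {n m} {ρ : Fin n → X → Carrier} {σ : Fin m → Pred X ℓ} at →
                      (∀ i → SatAtomAt i ρ σ at) → SatAtom V ρ σ at
  SatAtom-pointwise (s ≐ᴳ t) holds = lift holds
  SatAtom-pointwise (s ≐ᴸ t) holds = lift holds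

  module AtPoint (i : X) where

    at-i : (X → Carrier) → Carrier
    at-i f = f i

    at-i-isHomomorphism : GroupMorphisms.IsGroupHomomorphism (groupSort V) (AbelianGroup.rawGroup group) at-i
    at-i-isHomomorphism = record
      { isMonoidHomomorphism = record
        { isMagmaHomomorphism = record { isRelHomomorphism = record { cong = λ f≈g → f≈g i } ; homo = λ _ _ → refl }
        ; ε-homo = refl
        }
      ; ⁻¹-homo = λ _ → refl
      }

    open Forms (groupSort V)
    open Semantics (groupSort V) group at-i at-i-isHomomorphism
    open Satisfaction positivity

    module _ {n k m : ℕ} (cG : Fin n → X → Carrier) (xs : Vec Carrier k) (bits : Fin m → Bool)
             (ρ : Fin (n +ℕ k) → X → Carrier) (σ : Fin m → Pred X ℓ) where

      open Linearization (groupSort V) {n} {k} cG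

      ordered : ∀ κ f g {u v} → u ≈ ⟦ f ⟧ xs → v ≈ ⟦ g ⟧ xs → Holds xs (g -ᶠ f , κ) → u <[ κ ] v
      ordered κ f g u≈f v≈g holds =
        IsPositive⇒<[ κ ] (IsPositive-resp κ (trans (⟦f-ᶠg⟧ g f xs) (+-cong (sym v≈g) (-‿cong (sym u≈f)))) holds)

      module _ (ρ-at : ∀ j → ρ j i ≈ ⟦ linVar j ⟧ xs) where

        evalG-at : ∀ {t} (a : GAnn t) → All (Holds xs) (constraintsG a) → evalG V ρ t i ≈ ⟦ lin a ⟧ xs
        evalG-at (varₐ j) _ = ρ-at j
        evalG-at zerₐ     _ = sym (⟦constant⟧ _ xs)
        evalG-at (a +ₐ b) holds =
          trans (+-cong (evalG-at a (++⁻ˡ _ holds)) (evalG-at b (++⁻ʳ (constraintsG a) holds)))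
                (sym (⟦+ᶠ⟧ (lin a) (lin b) xs))
        evalG-at (-ₐ a) holds = trans (-‿cong (evalG-at a holds)) (sym (⟦-ᶠ⟧ (lin a) xs))
        evalG-at (minₐ true a b) (s≤t ∷ holds) = trans (x≤y⇒x⊓y≈x (ordered weak (lin a) (lin b) sa tb s≤t)) sa
          where sa = evalG-at a (++⁻ˡ _ holds) ; tb = evalG-at b (++⁻ʳ (constraintsG a) holds)
        evalG-at (minₐ false a b) (t<s ∷ holds) =
          trans (x≥y⇒x⊓y≈y (<⇒≤ (ordered strict (lin b) (lin a) tb sa t<s))) tb
          where sa = evalG-at a (++⁻ˡ _ holds) ; tb = evalG-at b (++⁻ʳ (constraintsG a) holds)
        evalG-at (maxₐ true a b) (t≤s ∷ holds) = trans (x≥y⇒x⊔y≈x (ordered weak (lin b) (lin a) tb sa t≤s)) sa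
          where sa = evalG-at a (++⁻ˡ _ holds) ; tb = evalG-at b (++⁻ʳ (constraintsG a) holds)
        evalG-at (maxₐ false a b) (s<t ∷ holds) =
          trans (x≤y⇒x⊔y≈y (<⇒≤ (ordered strict (lin a) (lin b) sa tb s<t))) tb
          where sa = evalG-at a (++⁻ˡ _ holds) ; tb = evalG-at b (++⁻ʳ (constraintsG a) holds)

        module _ (σ-at : ∀ j → σ j i ⇔ T (bits j)) where

          evalL-at : ∀ {t} (a : LAnn t) → All (Holds xs) (constraintsL a) → evalL V ρ σ t i ⇔ T (truth bits a)
          evalL-at (varₐ j) _ = σ-at j
          evalL-at ⊥ₐ       _ = mk⇔ (λ ()) (λ ())
          evalL-at ⊤ₐ       _ = mk⇔ (const tt) (const _)
          evalL-at (a ⊓ₐ b) holds =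
            ⇔-sym T-∧ ⇔-∘ (evalL-at a (++⁻ˡ _ holds) ×-⇔ evalL-at b (++⁻ʳ (constraintsL a) holds))
          evalL-at (a ⊔ₐ b) holds =
            ⇔-sym T-∨ ⇔-∘ (evalL-at a (++⁻ˡ _ holds) ⊎-⇔ evalL-at b (++⁻ʳ (constraintsL a) holds))
          evalL-at (Pₐ true g) (0≤g ∷ holds) =
            mk⇔ (const tt) (const (≤-respʳ-≈ (sym (evalG-at g holds)) 0≤g))
          evalL-at (Pₐ false g) (0<-g ∷ holds) =
            mk⇔ (λ 0≤g → 0<-g (≤-respˡ-≈ (sym (⟦-ᶠ⟧ (lin g) xs)) (0≤x⇒-x≤0 (≤-respʳ-≈ (evalG-at g holds) 0≤g)))) (λ ())

          atom-at : ∀ {at} (a : AtomAnn at) → Agrees bits a → All (Holds xs) (constraintsA a) → SatAtomAt i ρ σ at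
          atom-at (a ≐ᴳ b) _ (b≤a ∷ a≤b ∷ holds) =
            antisym (ordered weak (lin a) (lin b) sa tb a≤b) (ordered weak (lin b) (lin a) tb sa b≤a)
            where sa = evalG-at a (++⁻ˡ _ holds) ; tb = evalG-at b (++⁻ʳ (constraintsG a) holds)
          atom-at (a ≐ᴸ b) agree holds =
            ⇔-sym (evalL-at b (++⁻ʳ (constraintsL a) holds))
              ⇔-∘ ≡.subst (λ v → _ ⇔ T v) agree (evalL-at a (++⁻ˡ _ holds))

          atoms-at : ∀ {as} (anns : All AtomAnn as) → AllAgree bits anns → All (Holds xs) (constraints anns) →
                     All (SatAtomAt i ρ σ) as
          atoms-at []         _               _     = []
          atoms-at (a ∷ anns) (agree , agrees) holds =
            atom-at a agree (++⁻ˡ _ holds) ∷ atoms-at anns agrees (++⁻ʳ (constraintsA a) holds)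

module FrameSemantics {c ℓ x : Level} {Γ : DOAG c ℓ} {X : Set x}
                      {gc ge lc le : Level} {W : VLStructure gc ge lc le} (isValued : IsValuedLGroup W)
                      (e : Embedding (Stan Γ X) W) (i : X) where

  open FourierMotzkin
  open Annotation
  open ValuedLGroup using (groupSort; module Notation; module Properties)

  open Notation W
  open Properties isValued
  open PointFilter isValued e i
  open Embedding e using (fG; fG-cong; f-+; f--; f-0)
  open Lₒ using (≤-refl; ≤-reflexive; x∧y≤x; x∧y≤y; ∧≈⇒≤)

  frame-positivity : Frame → Positivity abelianGroup (x ⊔ℓ lsuc ℓ ⊔ℓ le)
  frame-positivity s = record
    { NonNeg      = λ a → ⊤L ⊢[ s ] P a
    ; Pos         = λ a → P (- a) ⊢[ s ] ⊥L
    ; NonNeg-resp = λ a≈b → weaken ≤-refl (≤-reflexive (P-cong a≈b))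
    ; Pos-resp    = λ a≈b → weaken (≤-reflexive (P-cong (-‿cong (sym a≈b)))) ≤-refl
    ; NonNeg-0    = axiom (≤-reflexive (Lₑ.sym P-0))
    ; NonNeg-+    = λ {a} {b} ⊢Pa ⊢Pb → weaken ≤-refl (∧≈⇒≤ (P-+ a b)) (⊢-⊓ʳ ⊢Pa ⊢Pb)
    ; Pos-+       = λ {a} {b} P-a⊢ ⊢Pb →
                      cut (weaken (x⊑⊤ _) (Lₒ.y≤x∨y _ _) ⊢Pb) (weaken (P-+-shift a b) ≤-refl P-a⊢)
    ; Pos⇒NonNeg  = λ {a} P-a⊢ → cut (axiom (⊤⊑P⊔P- a)) (weaken (x∧y≤y _ _) (⊥⊑x _) P-a⊢)
    }
    where
    P-+-shift : ∀ a b → P (- (a + b)) ⊓ P b ⊑ P (- a)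
    P-+-shift a b = Lₒ.≤-respʳ-≈ (P-cong (trans (+-congʳ (-‿distrib-+ a b)) (x-y+y≈x (- a) b))) (∧≈⇒≤ (P-+ _ _))

  module Needs {n m : ℕ} (ρ : Fin n → G) (σ : Fin m → L) where

    ⟦_⟧ᴳ : GTerm n → G
    ⟦ t ⟧ᴳ = evalG W ρ t

    -- the valuations whose truth the annotation of a term depends on
    needsG : GTerm n → List L
    needsG (var j)  = []
    needsG zer      = []
    needsG (s +ₜ t) = needsG s ++ needsG t
    needsG (negₜ t) = needsG t
    needsG (s ∧ₜ t) = P (⟦ t ⟧ᴳ - ⟦ s ⟧ᴳ) ∷ needsG s ++ needsG t
    needsG (s ∨ₜ t) = P (⟦ s ⟧ᴳ - ⟦ t ⟧ᴳ) ∷ needsG s ++ needsG t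

    needsL : LTerm n m → List L
    needsL (var j)  = []
    needsL botₜ     = []
    needsL topₜ     = []
    needsL (s ⊓ₜ t) = needsL s ++ needsL t
    needsL (s ⊔ₜ t) = needsL s ++ needsL t
    needsL (Pₜ g)   = P ⟦ g ⟧ᴳ ∷ needsG g

    needsA : Atom n m → List L
    needsA (s ≐ᴳ t) = needsG s ++ needsG t
    needsA (s ≐ᴸ t) = needsL s ++ needsL t

    needs : List (Atom n m) → List L
    needs []       = []
    needs (a ∷ as) = needsA a ++ needs as

    module _ {s : Frame} where

      annotateG : ∀ t → All (Decided s) (needsG t) → GAnn t
      annotateG (var j)  _ = varₐ j
      annotateG zer      _ = zerₐ
      annotateG (u +ₜ t) d = annotateG u (++⁻ˡ _ d) +ₐ annotateG t (++⁻ʳ (needsG u) d)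
      annotateG (negₜ t) d = -ₐ annotateG t d
      annotateG (u ∧ₜ t) ((b , _) ∷ d) = minₐ b (annotateG u (++⁻ˡ _ d)) (annotateG t (++⁻ʳ (needsG u) d))
      annotateG (u ∨ₜ t) ((b , _) ∷ d) = maxₐ b (annotateG u (++⁻ˡ _ d)) (annotateG t (++⁻ʳ (needsG u) d))

      annotateL : ∀ t → All (Decided s) (needsL t) → LAnn t
      annotateL (var j)  _ = varₐ j
      annotateL botₜ     _ = ⊥ₐ
      annotateL topₜ     _ = ⊤ₐ
      annotateL (u ⊓ₜ t) d = annotateL u (++⁻ˡ _ d) ⊓ₐ annotateL t (++⁻ʳ (needsL u) d)
      annotateL (u ⊔ₜ t) d = annotateL u (++⁻ˡ _ d) ⊔ₐ annotateL t (++⁻ʳ (needsL u) d)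
      annotateL (Pₜ g) ((b , _) ∷ d) = Pₐ b (annotateG g d)

      annotateA : ∀ a → All (Decided s) (needsA a) → AtomAnn a
      annotateA (u ≐ᴳ t) d = annotateG u (++⁻ˡ _ d) ≐ᴳ annotateG t (++⁻ʳ (needsG u) d)
      annotateA (u ≐ᴸ t) d = annotateL u (++⁻ˡ _ d) ≐ᴸ annotateL t (++⁻ʳ (needsL u) d)

      annotate : ∀ as → All (Decided s) (needs as) → All AtomAnn as
      annotate []       _ = []
      annotate (a ∷ as) d = annotateA a (++⁻ˡ _ d) ∷ annotate as (++⁻ʳ (needsA a) d)

  fG-isHomomorphism : GroupMorphisms.IsGroupHomomorphism (groupSort (Stan Γ X)) (AbelianGroup.rawGroup abelianGroup) fG
  fG-isHomomorphism = record
    { isMonoidHomomorphism = record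
      { isMagmaHomomorphism = record { isRelHomomorphism = record { cong = fG-cong } ; homo = f-+ }
      ; ε-homo = f-0
      }
    ; ⁻¹-homo = f--
    }

  module FrameOrder (s : Frame) where

    open Positivity (frame-positivity s) public

    0≤⇒NonNeg : ∀ {a} → 0# ≤ a → NonNeg a
    0≤⇒NonNeg 0≤a = axiom (0≤x⇒⊤⊑P 0≤a)

    refuted⇒Pos : ∀ {a b} → P (a - b) ⊢[ s ] ⊥L → Pos (b - a)
    refuted⇒Pos {a} {b} = weaken (≤-reflexive (P-cong (-‿anti-homo‿- b a))) ≤-refl

    P[0∧x]-NonNeg : ∀ {a b} → a ≈G 0# ∧ b → NonNeg b → NonNeg a
    P[0∧x]-NonNeg {a} {b} a≈0∧b = weaken ≤-refl (≤-reflexive (Lₑ.trans (Lₑ.sym (P[0∧x]≈P b)) (P-cong (sym a≈0∧b))))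

    ∧-≃ˡ : ∀ {a b} → NonNeg (b - a) → a ∧ b ≃ a
    ∧-≃ˡ {a} {b} b≥a = P[0∧x]-NonNeg ([x∧y]-x≈0∧[y-x] a b) b≥a , 0≤⇒NonNeg (x≤y⇒0≤y-x (Gₒ.x∧y≤x a b))

    ∧-≃ʳ : ∀ {a b} → NonNeg (a - b) → a ∧ b ≃ b
    ∧-≃ʳ {a} {b} a≥b = ≃-trans (≈⇒≃ (Gₑ.∧-comm a b)) (∧-≃ˡ a≥b)

    ∨-≃ˡ : ∀ {a b} → NonNeg (a - b) → a ∨ b ≃ a
    ∨-≃ˡ {a} {b} a≥b = 0≤⇒NonNeg (x≤y⇒0≤y-x (Gₒ.x≤x∨y a b)) , P[0∧x]-NonNeg (x-[x∨y]≈0∧[x-y] a b) a≥b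

    ∨-≃ʳ : ∀ {a b} → NonNeg (b - a) → a ∨ b ≃ b
    ∨-≃ʳ {a} {b} b≥a = ≃-trans (≈⇒≃ (Gₑ.∨-comm a b)) (∨-≃ˡ b≥a)

  module Linearize {n k m : ℕ} (cG : Fin n → X → DOAG.Carrier Γ) (ws : Vec G k)
                   (ρ : Fin (n +ℕ k) → G) (σ : Fin m → L) (s : Frame) where

    open Forms (groupSort (Stan Γ X))
    open Semantics (groupSort (Stan Γ X)) abelianGroup fG fG-isHomomorphism
    open Satisfaction (frame-positivity s) using (Holds)
    open FrameOrder s
    open Linearization (groupSort (Stan Γ X)) {n} {k} cG
    open Needs ρ σ

    infix 2 _∣_
    record Linearized {t : GTerm (n +ℕ k)} (a : GAnn t) : Set (c ⊔ℓ x ⊔ℓ lsuc ℓ ⊔ℓ le) where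
      constructor _∣_
      field
        ≃lin  : ⟦ t ⟧ᴳ ≃ ⟦ lin a ⟧ ws
        holds : All (Holds ws) (constraintsG a)

    difference-holds : ∀ κ {u t} {a : GAnn u} {b : GAnn t} → IsPositive κ (⟦ t ⟧ᴳ - ⟦ u ⟧ᴳ) →
                       Linearized a → Linearized b → Holds ws (lin b -ᶠ lin a , κ)
    difference-holds κ {a = a} {b} t≥u (u≃ ∣ _) (t≃ ∣ _) =
      IsPositive-resp κ (sym (⟦f-ᶠg⟧ (lin b) (lin a) ws)) (IsPositive-≃ κ (≃-+ t≃ (≃-‿ u≃)) t≥u)

    module _ (ρ-lin : ∀ j → ρ j ≈G ⟦ linVar j ⟧ ws) where

      linearizeG : ∀ t (d : All (Decided s) (needsG t)) → Linearized (annotateG t d)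
      linearizeG (var j)  _ = ≈⇒≃ (ρ-lin j) ∣ []
      linearizeG zer      _ = ≈⇒≃ (sym (trans (⟦constant⟧ _ ws) f-0)) ∣ []
      linearizeG (u +ₜ t) d with linearizeG u (++⁻ˡ _ d) | linearizeG t (++⁻ʳ (needsG u) d)
      ... | u≃ ∣ u-holds | t≃ ∣ t-holds =
        ≃-trans (≃-+ u≃ t≃) (≈⇒≃ (sym (⟦+ᶠ⟧ (lin a) (lin b) ws))) ∣ ++⁺ u-holds t-holds
        where a = annotateG u (++⁻ˡ _ d) ; b = annotateG t (++⁻ʳ (needsG u) d)
      linearizeG (negₜ t) d with linearizeG t d
      ... | t≃ ∣ t-holds = ≃-trans (≃-‿ t≃) (≈⇒≃ (sym (⟦-ᶠ⟧ (lin (annotateG t d)) ws))) ∣ t-holds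
      linearizeG (u ∧ₜ t) ((true , t≥u) ∷ d) with linearizeG u (++⁻ˡ _ d) | linearizeG t (++⁻ʳ (needsG u) d)
      ... | lu@(u≃ ∣ u-holds) | lt@(_ ∣ t-holds) =
        ≃-trans (∧-≃ˡ t≥u) u≃ ∣ difference-holds weak t≥u lu lt ∷ ++⁺ u-holds t-holds
      linearizeG (u ∧ₜ t) ((false , t-u⊢⊥) ∷ d) with linearizeG u (++⁻ˡ _ d) | linearizeG t (++⁻ʳ (needsG u) d)
      ... | lu@(_ ∣ u-holds) | lt@(t≃ ∣ t-holds) =
        ≃-trans (∧-≃ʳ (Pos⇒NonNeg u>t)) t≃ ∣ difference-holds strict u>t lt lu ∷ ++⁺ u-holds t-holds
        where u>t = refuted⇒Pos t-u⊢⊥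
      linearizeG (u ∨ₜ t) ((true , u≥t) ∷ d) with linearizeG u (++⁻ˡ _ d) | linearizeG t (++⁻ʳ (needsG u) d)
      ... | lu@(u≃ ∣ u-holds) | lt@(_ ∣ t-holds) =
        ≃-trans (∨-≃ˡ u≥t) u≃ ∣ difference-holds weak u≥t lt lu ∷ ++⁺ u-holds t-holds
      linearizeG (u ∨ₜ t) ((false , u-t⊢⊥) ∷ d) with linearizeG u (++⁻ˡ _ d) | linearizeG t (++⁻ʳ (needsG u) d)
      ... | lu@(_ ∣ u-holds) | lt@(t≃ ∣ t-holds) =
        ≃-trans (∨-≃ʳ (Pos⇒NonNeg t>u)) t≃ ∣ difference-holds strict t>u lu lt ∷ ++⁺ u-holds t-holds
        where t>u = refuted⇒Pos u-t⊢⊥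

      module _ (consistent : Consistent s) {bits : Fin m → Bool} (σ-verdict : ∀ j → Verdict s (bits j) (σ j)) where

        verdict-⊓ : ∀ b b′ {u v} → Verdict s b u → Verdict s b′ v → Verdict s (b ∧ᵇ b′) (u ⊓ v)
        verdict-⊓ true  true  ⊢u ⊢v = ⊢-⊓ʳ ⊢u ⊢v
        verdict-⊓ true  false _  v⊢ = weaken (x∧y≤y _ _) ≤-refl v⊢
        verdict-⊓ false _     u⊢ _  = weaken (x∧y≤x _ _) ≤-refl u⊢

        verdict-⊔ : ∀ b b′ {u v} → Verdict s b u → Verdict s b′ v → Verdict s (b ∨ᵇ b′) (u ⊔ v)
        verdict-⊔ true  _     ⊢u _  = weaken ≤-refl (Lₒ.x≤x∨y _ _) ⊢u
        verdict-⊔ false true  _  ⊢v = weaken ≤-refl (Lₒ.y≤x∨y _ _) ⊢v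
        verdict-⊔ false false u⊢ v⊢ = ⊢-⊔ˡ u⊢ v⊢

        verdicts-agree : ∀ b b′ {u v} → Verdict s b u → Verdict s b′ v → u ≈L v → b ≡ b′
        verdicts-agree true  true  _  _  _   = ≡.refl
        verdicts-agree false false _  _  _   = ≡.refl
        verdicts-agree true  false ⊢u v⊢ u≈v =
          ⊥-elim (consistent (⊢-contradiction ⊢u (weaken (≤-reflexive u≈v) ≤-refl v⊢)))
        verdicts-agree false true  u⊢ ⊢v u≈v =
          ⊥-elim (consistent (⊢-contradiction ⊢v (weaken (≤-reflexive (Lₑ.sym u≈v)) ≤-refl u⊢)))

        record LinearizedL {t : LTerm (n +ℕ k) m} (a : LAnn t) : Set (c ⊔ℓ x ⊔ℓ lsuc ℓ ⊔ℓ le) where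
          constructor _∣_
          field
            verdict : Verdict s (truth bits a) (evalL W ρ σ t)
            holds   : All (Holds ws) (constraintsL a)

        linearizeL : ∀ t (d : All (Decided s) (needsL t)) → LinearizedL (annotateL t d)
        linearizeL (var j) _ = σ-verdict j ∣ []
        linearizeL botₜ    _ = axiom ≤-refl ∣ []
        linearizeL topₜ    _ = axiom ≤-refl ∣ []
        linearizeL (u ⊓ₜ t) d with linearizeL u (++⁻ˡ _ d) | linearizeL t (++⁻ʳ (needsL u) d)
        ... | u-verdict ∣ u-holds | t-verdict ∣ t-holds = verdict-⊓ _ _ u-verdict t-verdict ∣ ++⁺ u-holds t-holds
        linearizeL (u ⊔ₜ t) d with linearizeL u (++⁻ˡ _ d) | linearizeL t (++⁻ʳ (needsL u) d)
        ... | u-verdict ∣ u-holds | t-verdict ∣ t-holds = verdict-⊔ _ _ u-verdict t-verdict ∣ ++⁺ u-holds t-holds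
        linearizeL (Pₜ g) ((true , ⊢Pg) ∷ d) with linearizeG g d
        ... | g≃ ∣ g-holds = ⊢Pg ∣ NonNeg-≃ g≃ ⊢Pg ∷ g-holds
        linearizeL (Pₜ g) ((false , Pg⊢) ∷ d) with linearizeG g d
        ... | g≃ ∣ g-holds = Pg⊢ ∣ Pos-resp (sym (⟦-ᶠ⟧ (lin (annotateG g d)) ws)) (Pos-≃ (≃-‿ g≃) 0<-g) ∷ g-holds
          where
          0<-g : Pos (- ⟦ g ⟧ᴳ)
          0<-g = weaken (≤-reflexive (P-cong (-‿involutive _))) ≤-refl Pg⊢

        linearizeA : ∀ at (d : All (Decided s) (needsA at)) → SatAtom W ρ σ at →
                     All (Holds ws) (constraintsA (annotateA at d)) × Agrees bits (annotateA at d)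
        linearizeA (u ≐ᴳ t) d (lift u≈t) with linearizeG u (++⁻ˡ _ d) | linearizeG t (++⁻ʳ (needsG u) d)
        ... | lu@(_ ∣ u-holds) | lt@(_ ∣ t-holds) =
          difference-holds weak (proj₁ (≈⇒≃ u≈t)) lt lu ∷ difference-holds weak (proj₂ (≈⇒≃ u≈t)) lu lt ∷
          ++⁺ u-holds t-holds , tt
        linearizeA (u ≐ᴸ t) d (lift u≈t) with linearizeL u (++⁻ˡ _ d) | linearizeL t (++⁻ʳ (needsL u) d)
        ... | u-verdict ∣ u-holds | t-verdict ∣ t-holds =
          ++⁺ u-holds t-holds , verdicts-agree _ _ u-verdict t-verdict u≈t

        linearize : ∀ as (d : All (Decided s) (needs as)) → All (SatAtom W ρ σ) as →
                    All (Holds ws) (constraints (annotate as d)) × AllAgree bits (annotate as d)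
        linearize []       _ []             = [] , tt
        linearize (a ∷ as) d (sat ∷ sats) with linearizeA a (++⁻ˡ _ d) sat | linearize as (++⁻ʳ (needsA a) d) sats
        ... | a-holds , a-agrees | as-holds , as-agree = ++⁺ a-holds as-holds , a-agrees , as-agree

module PointSolution {c ℓ x : Level} (em : ∀ {p} → ExcludedMiddle p) (Γ : DOAG c ℓ) (X : Set x)
                     {gc ge lc le : Level} {W : VLStructure gc ge lc le} (isValued : IsValuedLGroup W)
                     (e : Embedding (Stan Γ X) W)
                     {n m k k′ : ℕ} (cG : Fin n → X → DOAG.Carrier Γ) (cL : Fin m → Pred X ℓ)
                     (η : Fin k → VLStructure.G W) (θ : Fin k′ → VLStructure.L W)
                     (atoms : List (Annotation.Atom (n +ℕ k) (m +ℕ k′)))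
                     (sats : All (Annotation.SatAtom W ((Embedding.fG e ∘ cG) Vector.++ η)
                                                       ((Embedding.fL e ∘ cL) Vector.++ θ)) atoms)
                     where

  open FourierMotzkin
  open Annotation
  open ValuedLGroup using (groupSort)

  open DOAGProperties Γ using (Carrier; _≈_; sym; trans; x≤0⇒0≤-x)
  open Embedding e using (fG; fL; f-P; f--)
  open VLStructure W using (G; _≈G_)
  module Wₚ = ValuedLGroup.Properties isValued

  record Solution (i : X) : Set (c ⊔ℓ x ⊔ℓ lsuc ℓ) where
    open PointSemantics Γ X using (SatAtomAt)
    field
      values    : Fin k → Carrier
      truths    : Fin k′ → Bool
      satisfied : ∀ (η′ : Fin k → X → Carrier) (θ′ : Fin k′ → Pred X ℓ) →
                  (∀ a → η′ a i ≈ values a) → (∀ a → θ′ a i ⇔ T (truths a)) →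
                  All (SatAtomAt i (cG Vector.++ η′) (cL Vector.++ θ′)) atoms

  module AtPoint (i : X) where

    open PointFilter isValued e i
    open FrameSemantics isValued e i
    open PointSemantics Γ X using (V)
    open PointSemantics.AtPoint Γ X i using (at-i; at-i-isHomomorphism; atoms-at)
    open Linearization (groupSort V) {n} {k} cG using (linVar; constraints)
    open Needs ((fG ∘ cG) Vector.++ η) ((fL ∘ cL) Vector.++ θ) using (needs; annotate)
    open Extension (decideAll em initial-consistent (List.tabulate θ ++ needs atoms))

    truths : Fin k′ → Bool
    truths a = proj₁ (tabulate⁻ (++⁻ˡ (List.tabulate θ) decisions) a)

    bits : Fin (m +ℕ k′) → Bool
    bits = (λ b → isYes (em {P = cL b i})) Vector.++ truths

    σ-verdict : ∀ j → Verdict frame (bits j) (((fL ∘ cL) Vector.++ θ) j)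
    σ-verdict = Pointwise.++⁺ (λ l b → Verdict frame b l) (λ b → membership-verdict (em {P = cL b i}))
                              (λ a → proj₂ (tabulate⁻ (++⁻ˡ (List.tabulate θ) decisions) a))

    annotations : All AtomAnn atoms
    annotations = annotate atoms (++⁻ʳ (List.tabulate θ) decisions)

    ws : Vec G k
    ws = Vec.tabulate η

    module WSem = Semantics (groupSort V) Wₚ.abelianGroup fG fG-isHomomorphism
    module ΓSem = Semantics (groupSort V) (DOAGSolutions.group Γ) at-i at-i-isHomomorphism

    ρ-lin : ∀ j → ((fG ∘ cG) Vector.++ η) j ≈G WSem.⟦ linVar j ⟧ ws
    ρ-lin = Pointwise.++⁺ (λ g f → g ≈G WSem.⟦ f ⟧ ws) (λ b → Wₚ.sym (WSem.⟦constant⟧ (cG b) ws))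
                          (λ a → Wₚ.sym (Wₚ.trans (WSem.⟦coordinate⟧ a ws) (Wₚ.reflexive (lookup∘tabulate η a))))

    module WSat = WSem.Satisfaction (frame-positivity frame)
    module ΓSat = ΓSem.Satisfaction (DOAGSolutions.positivity Γ)

    linearized : All (WSat.Holds ws) (constraints annotations) × AllAgree bits annotations
    linearized = Linearize.linearize cG ws ((fG ∘ cG) Vector.++ η) ((fL ∘ cL) Vector.++ θ) frame ρ-lin
                   consistent σ-verdict atoms (++⁻ʳ (List.tabulate θ) decisions) sats

    transfer : ∀ κ f → WSat.IsPositive κ (fG f) → ΓSat.IsPositive κ (at-i f)
    transfer weak   f ⊤⊢Pf = ⊤⊢⇒∈ em consistent (weaken Lₒ.≤-refl (Lₒ.≤-reflexive (Lₑ.sym (f-P f))) ⊤⊢Pf)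
      where open Wₚ using (module Lₒ; module Lₑ)
    transfer strict f P-f⊢ fi≤0 =
      ⊢⊥⇒∉ consistent (weaken (Lₒ.≤-reflexive (Lₑ.trans (f-P (λ j → DOAG.-_ Γ (f j))) (P-cong (f-- f))))
                              Lₒ.≤-refl P-f⊢)
           (x≤0⇒0≤-x fi≤0)
      where open Wₚ using (module Lₒ; module Lₑ; P-cong)

    solved : ∃ λ xs → All (ΓSat.Holds xs) (constraints annotations)
    solved = DOAGSolutions.Completeness.solve Γ (groupSort V) at-i at-i-isHomomorphism fG-isHomomorphism
               (frame-positivity frame) transfer (constraints annotations) ws (proj₁ linearized)

    xs : Vec Carrier k
    xs = proj₁ solved

    ρ-at : ∀ η′ → (∀ a → η′ a i ≈ Vec.lookup xs a) → ∀ j → (cG Vector.++ η′) j i ≈ ΓSem.⟦ linVar j ⟧ xs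
    ρ-at η′ η′-at = Pointwise.++⁺ (λ g f → g i ≈ ΓSem.⟦ f ⟧ xs) {xs = cG} {xs′ = η′}
                                  (λ b → sym (ΓSem.⟦constant⟧ (cG b) xs))
                                  (λ a → trans (η′-at a) (sym (ΓSem.⟦coordinate⟧ a xs)))

    σ-at : ∀ θ′ → (∀ a → θ′ a i ⇔ T (truths a)) → ∀ j → (cL Vector.++ θ′) j i ⇔ T (bits j)
    σ-at θ′ θ′-at =
      Pointwise.++⁺ (λ S b → S i ⇔ T b) {xs = cL} {xs′ = θ′} (λ b → mk⇔ fromWitness toWitness) θ′-at

    solution : Solution i
    solution = record
      { values    = Vec.lookup xs
      ; truths    = truths
      ; satisfied = λ η′ θ′ η′-at θ′-at →
          atoms-at cG xs bits (cG Vector.++ η′) (cL Vector.++ θ′) (ρ-at η′ η′-at) (σ-at θ′ θ′-at)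
                   annotations (proj₂ linearized) (proj₂ solved)
      }

-- only the valued ℓ-group structure of W is used, not its density
stan-algebraicallyClosed : (∀ {p} → ExcludedMiddle p) → ∀ {c ℓ x} (Γ : DOAG c ℓ) (X : Set x) →
                           AlgebraicallyClosed (Stan Γ X)
stan-algebraicallyClosed em {ℓ = ℓ} Γ X W isDense e φ cG cL sat =
  entails cG cL η′ θ′ (All.tabulate (λ {at} at∈atoms →
    PointSemantics.SatAtom-pointwise Γ X at (λ i → All.lookup (satisfied-at i) at∈atoms)))
  where
  open Embedding e using (fG; fL)
  open ConjunctiveForm.Extraction (Stan Γ X) W using (conjunction; module Conjunction)
  open Conjunction (conjunction φ (fG ∘ cG) (fL ∘ cL) sat)
  module Solve = PointSolution em Γ X (IsDenselyValuedLGroup.isValuedLGroup isDense) e cG cL η θ atoms holds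
  open PointSolution.Solution

  η′ : Fin k → X → DOAG.Carrier Γ
  η′ a i = values (Solve.AtPoint.solution i) a

  θ′ : Fin k′ → Pred X ℓ
  θ′ a i = Lift ℓ (T (truths (Solve.AtPoint.solution i) a))

  satisfied-at : ∀ i → All (PointSemantics.SatAtomAt Γ X i (cG Vector.++ η′) (cL Vector.++ θ′)) atoms
  satisfied-at i = satisfied (Solve.AtPoint.solution i) η′ θ′ (λ _ → DOAGProperties.refl Γ) (λ _ → mk⇔ lower lift)

mainTheorem7 : (∀ {p} → ExcludedMiddle p)
    → ∀ {c ℓ x} (Γ : DOAG c ℓ) (X : Set x)
    → IsAlgClosedDenselyValuedLGroup (Stan Γ X)
mainTheorem7 em Γ X = record
  { isDenselyValued     = StanValued.stan-isDenselyValued Γ X em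
  ; algebraicallyClosed = stan-algebraicallyClosed em Γ X
  }
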